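{- Let $\alpha$ be an indeterminate and let $\boldsymbol\beta=(\beta_n)_{n\ge1}$ with $\beta_n=n(n+\alpha)$, and $\boldsymbol\gamma=\mathbf 0$. Then for all $n,k\ge0$, $$J_{n,k}(\boldsymbol\beta,\mathbf 0)=\sum_{G\in\mathbf{LD}^{\rm alt}_{n,k}}(1+\alpha)^{\mathrm{cyc}(G)},$$ i.e. $J_{n,k}(\boldsymbol\beta,\mathbf 0)$ enumerates alternating Laguerre digraphs on $[n]$ with $k$ paths with a weight $1+\alpha$ for each cycle.
   Context: $J_{n,k}(\boldsymbol\beta,\boldsymbol\gamma)$ is the generating polynomial of lattice paths from $(0,0)$ to $(n,k)$ staying in $\mathbb Z\times\mathbb N$ with steps $(1,1)$ (rise, weight 1), $(1,-1)$ (fall; weight $\beta_i$ when falling from height $i$) and $(1,0)$ (level step; weight $\gamma_i$ at height $i$); with $\boldsymbol\gamma=\mathbf 0$ only paths without level steps contribute. A Laguerre digraph on $[n]$ is a directed graph on vertex set $[n]$ (loops allowed) in which each vertex has in-degree 0 or 1 and out-degree 0 or 1; its weakly connected components are directed paths (an isolated vertex being a path of length 0) and directed cycles (a loop being a cycle of length 1). $\mathrm{cyc}(G)$ is the number of cycles. Use 0–0 boundary conditions: for $i\in[n]$ let $p(i)$ be its predecessor if it has in-degree 1 and $p(i)=0$ otherwise, and $s(i)$ its successor if it has out-degree 1 and $s(i)=0$ otherwise. Vertex $i$ is a peak if $p(i)<i>s(i)$, a valley if $p(i)>i<s(i)$, a double ascent if $p(i)<i<s(i)$, a double descent if $p(i)>i>s(i)$,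 a fixed point if $p(i)=i=s(i)$. $G$ is alternating if it has no double ascents, double descents or fixed points. $\mathbf{LD}^{\rm alt}_{n,k}$ is the set of alternating Laguerre digraphs on $[n]$ with exactly $k$ path components. -}

module Defs where

open import Level using (Level)
open import Data.Bool using (Bool; true; false; _∧_; _∨_; not; if_then_else_)
open import Data.Nat using (ℕ; zero; suc; _<ᵇ_; _≡ᵇ_)
open import Data.Fin using (Fin; toℕ)
open import Data.Maybe using (Maybe; just; nothing)
open import Data.List using (List; []; _∷_; map; concatMap; filter; foldr; allFin; length; upTo)
import Data.List as L
open import Data.Vec using (Vec; []; _∷_; lookup)
open import Algebra.Bundles using (CommutativeSemiring)
open import Relation.Nullary.Decidable using (Dec; yes; no)
open import Data.Bool.Properties using (T?)

allVecs : ∀ {a} {A : Set a} → List A → (n : ℕ) → List (Vec A n)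
allVecs xs zero    = [] ∷ []
allVecs xs (suc n) = concatMap (λ x → map (x ∷_) (allVecs xs n)) xs

allB : ∀ {a} {A : Set a} → (A → Bool) → List A → Bool
allB p = foldr (λ x b → p x ∧ b) true

anyB : ∀ {a} {A : Set a} → (A → Bool) → List A → Bool
anyB p = foldr (λ x b → p x ∨ b) false

countB : ∀ {a} {A : Set a} → (A → Bool) → List A → ℕ
countB p = foldr (λ x m → if p x then suc m else m) zero

filterB : ∀ {a} {A : Set a} → (A → Bool) → List A → List A
filterB p = foldr (λ x xs → if p x then x ∷ xs else xs) []

data Step : Set where
  rise fall level : Step

allSteps : List Step
allSteps = rise ∷ fall ∷ level ∷ []

validFrom : ∀ {n} → ℕ → ℕ → Vec Step n → Bool
validFrom h k []            = h ≡ᵇ k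
validFrom h k (rise  ∷ ss)  = validFrom (suc h) k ss
validFrom zero k (fall ∷ ss)    = false
validFrom (suc h) k (fall ∷ ss) = validFrom h k ss
validFrom h k (level ∷ ss)  = validFrom h k ss

pathsNK : (n k : ℕ) → List (Vec Step n)
pathsNK n k = filterB (validFrom zero k) (allVecs allSteps n)

-- Laguerre digraphs on [n]
-- A Laguerre digraph on [n] (vertices Fin n, vertex i standing for i+1)
-- is encoded by its partial successor map succ : Fin n → Maybe (Fin n)
-- (succ i = just j iff there is an edge i → j); out-degree ≤ 1 is built
-- in, in-degree ≤ 1 is injectivity of succ on its domain.

SuccMap : ℕ → Set
SuccMap n = Vec (Maybe (Fin n)) n

eqFin : ∀ {n} → Fin n → Fin n → Bool
eqFin i j = toℕ i ≡ᵇ toℕ j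

edge : ∀ {n} → SuccMap n → Fin n → Fin n → Bool
edge σ i j with lookup σ i
... | nothing = false
... | just j′ = eqFin j′ j

isLaguerre : ∀ {n} → SuccMap n → Bool
isLaguerre {n} σ =
  allB (λ j → allB (λ i₁ → allB (λ i₂ →
         not (edge σ i₁ j ∧ edge σ i₂ j) ∨ eqFin i₁ i₂) (allFin n)) (allFin n)) (allFin n)

allLaguerre : (n : ℕ) → List (SuccMap n)
allLaguerre n = filterB isLaguerre (allVecs (nothing ∷ map just (allFin n)) n)

lab : ∀ {n} → Fin n → ℕ
lab i = suc (toℕ i)

sLab : ∀ {n} → SuccMap n → Fin n → ℕ
sLab σ i with lookup σ i
... | nothing = zero
... | just j  = lab j

-- p(i) with 0 boundary condition (the unique j with j → i, if any)
pLab : ∀ {n} → SuccMap n → Fin n → ℕ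
pLab {n} σ i = foldr (λ j r → if edge σ j i then lab j else r) zero (allFin n)

hasPred : ∀ {n} → SuccMap n → Fin n → Bool
hasPred {n} σ i = anyB (λ j → edge σ j i) (allFin n)

isDoubleAscent isDoubleDescent isFixedPoint : ∀ {n} → SuccMap n → Fin n → Bool
isDoubleAscent  σ i = (pLab σ i <ᵇ lab i) ∧ (lab i <ᵇ sLab σ i)
isDoubleDescent σ i = (lab i <ᵇ pLab σ i) ∧ (sLab σ i <ᵇ lab i)
isFixedPoint    σ i = (pLab σ i ≡ᵇ lab i) ∧ (lab i ≡ᵇ sLab σ i)

isAlternating : ∀ {n} → SuccMap n → Bool
isAlternating {n} σ =
  allB (λ i → not (isDoubleAscent σ i ∨ isDoubleDescent σ i ∨ isFixedPoint σ i)) (allFin n)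

iter : ∀ {n} → SuccMap n → ℕ → Fin n → Maybe (Fin n)
iter σ zero    i = just i
iter σ (suc m) i with iter σ m i
... | nothing = nothing
... | just j  = lookup σ j

reachesIn : ∀ {n} → SuccMap n → ℕ → Fin n → Fin n → Bool
reachesIn σ m i j with iter σ m i
... | nothing = false
... | just j′ = eqFin j′ j

onCycle : ∀ {n} → SuccMap n → Fin n → Bool
onCycle {n} σ i = anyB (λ m → reachesIn σ (suc m) i i) (upTo n)

cycleRep : ∀ {n} → SuccMap n → Fin n → Bool
cycleRep {n} σ i = onCycle σ i ∧
  allB (λ m → allB (λ j → not (reachesIn σ (suc m) i j) ∨ (toℕ i <ᵇ suc (toℕ j)))
                   (allFin n)) (upTo n)

cyc : ∀ {n} → SuccMap n → ℕ
cyc {n} σ = countB (cycleRep σ) (allFin n)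

-- number of path components (each counted once, via its initial vertex,
-- the unique vertex of in-degree 0 of that path)
numPaths : ∀ {n} → SuccMap n → ℕ
numPaths {n} σ = countB (λ i → not (hasPred σ i)) (allFin n)

LDalt : (n k : ℕ) → List (SuccMap n)
LDalt n k = filterB (λ σ → isAlternating σ ∧ (numPaths σ ≡ᵇ k)) (allLaguerre n)

module Weights {c ℓ : Level} (R : CommutativeSemiring c ℓ) where
  open CommutativeSemiring R using (Carrier; _+_; _*_; 0#; 1#)

  sumR : List Carrier → Carrier
  sumR = foldr _+_ 0#

  ι : ℕ → Carrier
  ι zero    = 0#
  ι (suc m) = 1# + ι m

  pow : Carrier → ℕ → Carrier
  pow x zero    = 1#
  pow x (suc m) = x * pow x m

  weightFrom : ∀ {n} → (ℕ → Carrier) → (ℕ → Carrier) → ℕ → Vec Step n → Carrier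
  weightFrom β γ h []              = 1#
  weightFrom β γ h (rise ∷ ss)     = weightFrom β γ (suc h) ss
  weightFrom β γ zero (fall ∷ ss)  = 0#
  weightFrom β γ (suc h) (fall ∷ ss) = β (suc h) * weightFrom β γ h ss
  weightFrom β γ h (level ∷ ss)    = γ h * weightFrom β γ h ss

  J : (n k : ℕ) → (β γ : ℕ → Carrier) → Carrier
  J n k β γ = sumR (map (weightFrom β γ zero) (pathsNK n k))

-- Both sides satisfy S(n+1, k) = S(n, k-1) + β(k+1) S(n, k+1) with S(0, k) = δ(0, k).
-- For lattice paths this is the decomposition by the last step.  For an alternating digraph
-- on [n+1], look at the least vertex 1: its boundary-0 convention forbids it to be a double
-- ascent, a double descent or a fixed point, so it is either isolated (a peak; deleting it
-- leaves k-1 paths) or a valley u → 1 → w.  Deleting a valley leaves an alternating digraph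
-- on [n] with k+1 paths in which u ends a path and w starts one; conversely each of the
-- (k+1)² pairs (end, start) can be joined through 1, and exactly the k+1 pairs lying on the
-- same path close a cycle, giving the factor (k+1)(k+1) + (k+1)α = β(k+1).  Since 1 lies
-- below every other label, the relabelling i ↦ i+1 does not change the type of any other vertex.

module Submission where

open import Defs
open import Level using (Level)
open import Data.Bool using (Bool; true; false; T; _∧_; _∨_; not; if_then_else_)
open import Data.Bool.Properties using (∧-conicalˡ; ∧-conicalʳ; ∧-identityʳ; ¬-not; not-injective; not-involutive)
open import Data.Nat as ℕ using (ℕ; zero; suc; _∸_; _≤_; _<_; z≤n; s≤s; _<ᵇ_; _≡ᵇ_)
import Data.Nat.Properties as ℕₚ
open ℕₚ using (≤-trans; ≤-refl; ≤-pred; n<1+n; <⇒≤; m≤n⇒m<n∨m≡n; m<n⇒0<n∸m; m+[n∸m]≡n; m∸n≤m;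
              <-≤-trans; <-trans; <-cmp; ≡ᵇ⇒≡)
open import Data.Fin using (Fin; zero; suc; toℕ)
open import Data.Fin.Properties using (pigeonhole; toℕ<n; suc-injective; 0≢1+n)
open import Data.Maybe using (Maybe; just; nothing; is-nothing; fromMaybe)
import Data.Maybe as Maybe
open import Data.Maybe.Properties using (just-injective)
open import Data.List using (List; []; _∷_; map; foldr; allFin; tabulate; upTo; applyUpTo; length; concatMap; _++_)
import Data.List.Properties as List
open import Data.Vec using (Vec; []; _∷_; lookup; _[_]≔_)
import Data.Vec as Vec
open import Data.Vec.Properties using (lookup-map; lookup∘update; lookup∘update′)
open import Data.Product using (_×_; _,_; proj₂; ∃)
open import Data.Sum using (_⊎_; inj₁; inj₂)
open import Data.Unit using (⊤; tt)
open import Data.Empty using (⊥-elim)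
open import Relation.Binary using (tri<; tri≈; tri>)
open import Relation.Binary.PropositionalEquality using (_≡_; _≢_; refl; sym; trans; cong; cong₂; subst; module ≡-Reasoning)
open import Function using (_∘_; id)
open import Algebra.Bundles using (CommutativeSemiring)
import Algebra.Properties.CommutativeSemigroup as CommutativeSemigroupProperties

true≢false : true ≢ false
true≢false ()

just≢nothing : ∀ {A : Set} {x : A} → just x ≢ nothing
just≢nothing ()

bool-ext : ∀ {a b : Bool} → (a ≡ true → b ≡ true) → (b ≡ true → a ≡ true) → a ≡ b
bool-ext {false} {false} _ _ = refl
bool-ext {false} {true}  _ g = g refl
bool-ext {true}  {false} f _ = sym (f refl)
bool-ext {true}  {true}  _ _ = refl

∧-intro : ∀ {a b} → a ≡ true → b ≡ true → a ∧ b ≡ true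
∧-intro refl refl = refl

∨-elim : ∀ {a b} → a ∨ b ≡ true → a ≡ true ⊎ b ≡ true
∨-elim {true}  _ = inj₁ refl
∨-elim {false} e = inj₂ e

∨-introˡ : ∀ {a b} → a ≡ true → a ∨ b ≡ true
∨-introˡ refl = refl

∨-introʳ : ∀ {a b} → b ≡ true → a ∨ b ≡ true
∨-introʳ {true}  _ = refl
∨-introʳ {false} e = e

eqFin⇒≡ : ∀ {n} (i j : Fin n) → eqFin i j ≡ true → i ≡ j
eqFin⇒≡ zero    zero    _ = refl
eqFin⇒≡ (suc i) (suc j) e = cong suc (eqFin⇒≡ i j e)

eqFin-refl : ∀ {n} (i : Fin n) → eqFin i i ≡ true
eqFin-refl zero    = refl
eqFin-refl (suc i) = eqFin-refl i

foldr-tabulate : ∀ {b} {A : Set} {B : Set b} {n} (c : A → B → B) (z : B) (f : Fin n → A) →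
  foldr c z (tabulate f) ≡ foldr (c ∘ f) z (allFin n)
foldr-tabulate {n = zero}  c z f = refl
foldr-tabulate {n = suc n} c z f =
  cong (c (f zero)) (trans (foldr-tabulate c z (f ∘ suc)) (sym (foldr-tabulate (c ∘ f) z suc)))

foldr-allFin-suc : ∀ {b} {B : Set b} {n} (c : Fin (suc n) → B → B) (z : B) →
  foldr c z (allFin (suc n)) ≡ c zero (foldr (c ∘ suc) z (allFin n))
foldr-allFin-suc c z = cong (c zero) (foldr-tabulate c z suc)

foldr-cong : ∀ {A B : Set} {c d : A → B → B} (z : B) (xs : List A) →
  (∀ x r → c x r ≡ d x r) → foldr c z xs ≡ foldr d z xs
foldr-cong         z []       h = refl
foldr-cong {c = c} z (x ∷ xs) h = trans (cong (c x) (foldr-cong z xs h)) (h x _)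

allB-cong : ∀ {A : Set} {p q : A → Bool} xs → (∀ x → p x ≡ q x) → allB p xs ≡ allB q xs
allB-cong xs h = foldr-cong true xs (λ x r → cong (_∧ r) (h x))

anyB-cong : ∀ {A : Set} {p q : A → Bool} xs → (∀ x → p x ≡ q x) → anyB p xs ≡ anyB q xs
anyB-cong xs h = foldr-cong false xs (λ x r → cong (_∨ r) (h x))

countB-cong : ∀ {A : Set} {p q : A → Bool} xs → (∀ x → p x ≡ q x) → countB p xs ≡ countB q xs
countB-cong xs h = foldr-cong zero xs (λ x r → cong (λ b → if b then suc r else r) (h x))

allB-allFin-suc : ∀ {n} (p : Fin (suc n) → Bool) → allB p (allFin (suc n)) ≡ (p zero ∧ allB (p ∘ suc) (allFin n))
allB-allFin-suc p = foldr-allFin-suc (λ x b → p x ∧ b) true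

anyB-allFin-suc : ∀ {n} (p : Fin (suc n) → Bool) → anyB p (allFin (suc n)) ≡ (p zero ∨ anyB (p ∘ suc) (allFin n))
anyB-allFin-suc p = foldr-allFin-suc (λ x b → p x ∨ b) false

countB-allFin-suc : ∀ {n} (p : Fin (suc n) → Bool) →
  countB p (allFin (suc n)) ≡ (if p zero then suc (countB (p ∘ suc) (allFin n)) else countB (p ∘ suc) (allFin n))
countB-allFin-suc p = foldr-allFin-suc (λ x m → if p x then suc m else m) zero

allB-allFin⇒ : ∀ {n} (p : Fin n → Bool) → allB p (allFin n) ≡ true → ∀ i → p i ≡ true
allB-allFin⇒ {suc n} p e zero    rewrite allB-allFin-suc p = ∧-conicalˡ _ _ e
allB-allFin⇒ {suc n} p e (suc i) rewrite allB-allFin-suc p = allB-allFin⇒ (p ∘ suc) (∧-conicalʳ _ _ e) i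

⇒allB-allFin : ∀ {n} (p : Fin n → Bool) → (∀ i → p i ≡ true) → allB p (allFin n) ≡ true
⇒allB-allFin {zero}  p h = refl
⇒allB-allFin {suc n} p h rewrite allB-allFin-suc p = ∧-intro (h zero) (⇒allB-allFin (p ∘ suc) (h ∘ suc))

anyB-allFin⇒ : ∀ {n} (p : Fin n → Bool) → anyB p (allFin n) ≡ true → ∃ λ i → p i ≡ true
anyB-allFin⇒ {suc n} p e rewrite anyB-allFin-suc p with ∨-elim {p zero} e
... | inj₁ h = zero , h
... | inj₂ h with anyB-allFin⇒ (p ∘ suc) h
...   | i , hi = suc i , hi

⇒anyB-allFin : ∀ {n} (p : Fin n → Bool) (i : Fin n) → p i ≡ true → anyB p (allFin n) ≡ true
⇒anyB-allFin {suc n} p zero    e rewrite anyB-allFin-suc p = ∨-introˡ e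
⇒anyB-allFin {suc n} p (suc i) e rewrite anyB-allFin-suc p = ∨-introʳ {p zero} (⇒anyB-allFin (p ∘ suc) i e)

anyB-allFin-none : ∀ {n} (p : Fin n → Bool) → (∀ i → p i ≡ false) → anyB p (allFin n) ≡ false
anyB-allFin-none p h = ¬-not λ e → let (i , hi) = anyB-allFin⇒ p e in true≢false (trans (sym hi) (h i))

allB-applyUpTo⇒ : ∀ N (f : ℕ → ℕ) (p : ℕ → Bool) → allB p (applyUpTo f N) ≡ true → ∀ m → m < N → p (f m) ≡ true
allB-applyUpTo⇒ (suc N) f p e zero    _        = ∧-conicalˡ _ _ e
allB-applyUpTo⇒ (suc N) f p e (suc m) (s≤s lt) = allB-applyUpTo⇒ N (f ∘ suc) p (∧-conicalʳ (p (f 0)) _ e) m lt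

⇒allB-applyUpTo : ∀ N (f : ℕ → ℕ) (p : ℕ → Bool) → (∀ m → m < N → p (f m) ≡ true) → allB p (applyUpTo f N) ≡ true
⇒allB-applyUpTo zero    f p h = refl
⇒allB-applyUpTo (suc N) f p h =
  ∧-intro (h 0 (s≤s z≤n)) (⇒allB-applyUpTo N (f ∘ suc) p (λ m lt → h (suc m) (s≤s lt)))

anyB-applyUpTo⇒ : ∀ N (f : ℕ → ℕ) (p : ℕ → Bool) → anyB p (applyUpTo f N) ≡ true → ∃ λ m → m < N × p (f m) ≡ true
anyB-applyUpTo⇒ (suc N) f p e with ∨-elim {p (f 0)} e
... | inj₁ h = 0 , s≤s z≤n , h
... | inj₂ h with anyB-applyUpTo⇒ N (f ∘ suc) p h
...   | m , lt , hm = suc m , s≤s lt , hm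

⇒anyB-applyUpTo : ∀ N (f : ℕ → ℕ) (p : ℕ → Bool) m → m < N → p (f m) ≡ true → anyB p (applyUpTo f N) ≡ true
⇒anyB-applyUpTo (suc N) f p zero    lt       e = ∨-introˡ e
⇒anyB-applyUpTo (suc N) f p (suc m) (s≤s lt) e = ∨-introʳ {p (f 0)} (⇒anyB-applyUpTo N (f ∘ suc) p m lt e)

countB-none : ∀ {n} (p : Fin n → Bool) → (∀ i → p i ≡ false) → countB p (allFin n) ≡ 0
countB-none {zero}  p h = refl
countB-none {suc n} p h rewrite countB-allFin-suc p | h zero = countB-none (p ∘ suc) (h ∘ suc)

countB-atMostOne : ∀ {n} (p : Fin n → Bool) → (∀ a b → p a ≡ true → p b ≡ true → a ≡ b) →
  countB p (allFin n) ≡ (if anyB p (allFin n) then 1 else 0)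
countB-atMostOne {zero}  p h = refl
countB-atMostOne {suc n} p h rewrite countB-allFin-suc p | anyB-allFin-suc p with p zero in e0
... | true  = cong suc (countB-none (p ∘ suc) λ i → ¬-not λ ei → 0≢1+n (h zero (suc i) e0 ei))
... | false = countB-atMostOne (p ∘ suc) (λ a b ea eb → suc-injective (h (suc a) (suc b) ea eb))

countB-unique : ∀ {n} (p : Fin n → Bool) → (∀ a b → p a ≡ true → p b ≡ true → a ≡ b) →
  ∀ a → p a ≡ true → countB p (allFin n) ≡ 1
countB-unique p h a e = trans (countB-atMostOne p h) (cong (λ b → if b then 1 else 0) (⇒anyB-allFin p a e))

countB-+-countB-not : ∀ {A : Set} (p : A → Bool) xs → countB p xs ℕ.+ countB (not ∘ p) xs ≡ length xs
countB-+-countB-not p []       = refl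
countB-+-countB-not p (x ∷ xs) with p x
... | true  = cong suc (countB-+-countB-not p xs)
... | false = trans (ℕₚ.+-suc _ _) (cong suc (countB-+-countB-not p xs))

module Sums {c ℓ : Level} (R : CommutativeSemiring c ℓ) where
  open CommutativeSemiring R hiding (zero) renaming (refl to ≈-refl; sym to ≈-sym; trans to ≈-trans)
  open Weights R
  open CommutativeSemigroupProperties +-commutativeSemigroup using () renaming (interchange to +-interchange)

  ∑ : ∀ {A : Set} → (A → Carrier) → List A → Carrier
  ∑ f xs = sumR (map f xs)

  ∑-cong : ∀ {A : Set} {f g : A → Carrier} xs → (∀ x → f x ≈ g x) → ∑ f xs ≈ ∑ g xs
  ∑-cong []       h = ≈-refl
  ∑-cong (x ∷ xs) h = +-cong (h x) (∑-cong xs h)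

  ∑-zero : ∀ {A : Set} {f : A → Carrier} xs → (∀ x → f x ≈ 0#) → ∑ f xs ≈ 0#
  ∑-zero []       h = ≈-refl
  ∑-zero (x ∷ xs) h = ≈-trans (+-cong (h x) (∑-zero xs h)) (+-identityˡ 0#)

  ∑-+ : ∀ {A : Set} (f g : A → Carrier) xs → ∑ (λ x → f x + g x) xs ≈ ∑ f xs + ∑ g xs
  ∑-+ f g []       = ≈-sym (+-identityˡ 0#)
  ∑-+ f g (x ∷ xs) = ≈-trans (+-congˡ (∑-+ f g xs)) (+-interchange (f x) (g x) _ _)

  ∑-*ˡ : ∀ {A : Set} (k : Carrier) (f : A → Carrier) xs → ∑ (λ x → k * f x) xs ≈ k * ∑ f xs
  ∑-*ˡ k f []       = ≈-sym (zeroʳ k)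
  ∑-*ˡ k f (x ∷ xs) = ≈-trans (+-congˡ (∑-*ˡ k f xs)) (≈-sym (distribˡ k (f x) _))

  ∑-*ʳ : ∀ {A : Set} (k : Carrier) (f : A → Carrier) xs → ∑ (λ x → f x * k) xs ≈ ∑ f xs * k
  ∑-*ʳ k f xs = ≈-trans (∑-cong xs (λ x → *-comm (f x) k)) (≈-trans (∑-*ˡ k f xs) (*-comm k _))

  ∑-++ : ∀ {A : Set} (f : A → Carrier) xs ys → ∑ f (xs ++ ys) ≈ ∑ f xs + ∑ f ys
  ∑-++ f []       ys = ≈-sym (+-identityˡ _)
  ∑-++ f (x ∷ xs) ys = ≈-trans (+-congˡ (∑-++ f xs ys)) (≈-sym (+-assoc _ _ _))

  ∑-map : ∀ {A B : Set} (f : B → Carrier) (g : A → B) xs → ∑ f (map g xs) ≡ ∑ (f ∘ g) xs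
  ∑-map f g []       = refl
  ∑-map f g (x ∷ xs) = cong (f (g x) +_) (∑-map f g xs)

  ∑-concatMap : ∀ {A B : Set} (f : B → Carrier) (g : A → List B) xs → ∑ f (concatMap g xs) ≈ ∑ (λ x → ∑ f (g x)) xs
  ∑-concatMap f g []       = ≈-refl
  ∑-concatMap f g (x ∷ xs) = ≈-trans (∑-++ f (g x) (concatMap g xs)) (+-congˡ (∑-concatMap f g xs))

  ∑-swap : ∀ {A B : Set} (f : A → B → Carrier) xs ys → ∑ (λ a → ∑ (f a) ys) xs ≈ ∑ (λ b → ∑ (λ a → f a b) xs) ys
  ∑-swap f []       ys = ≈-sym (∑-zero ys (λ _ → ≈-refl))
  ∑-swap f (x ∷ xs) ys = ≈-trans (+-congˡ (∑-swap f xs ys)) (≈-sym (∑-+ (f x) (λ b → ∑ (λ a → f a b) xs) ys))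

  ∑-filterB : ∀ {A : Set} (f : A → Carrier) (p : A → Bool) xs → ∑ f (filterB p xs) ≈ ∑ (λ x → if p x then f x else 0#) xs
  ∑-filterB f p []       = ≈-refl
  ∑-filterB f p (x ∷ xs) with p x
  ... | true  = +-congˡ (∑-filterB f p xs)
  ... | false = ≈-trans (∑-filterB f p xs) (≈-sym (+-identityˡ _))

  ∑-indicator : ∀ {A : Set} (p : A → Bool) (k : Carrier) xs → ∑ (λ x → if p x then k else 0#) xs ≈ ι (countB p xs) * k
  ∑-indicator p k []       = ≈-sym (zeroˡ k)
  ∑-indicator p k (x ∷ xs) with p x
  ... | true  = ≈-trans (+-congˡ (∑-indicator p k xs)) (≈-trans (+-congʳ (≈-sym (*-identityˡ k))) (≈-sym (distribʳ k 1# _)))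
  ... | false = ≈-trans (+-identityˡ _) (∑-indicator p k xs)

  ∑-allFin-suc : ∀ {n} (f : Fin (suc n) → Carrier) → ∑ f (allFin (suc n)) ≈ f zero + ∑ (f ∘ suc) (allFin n)
  ∑-allFin-suc {n} f = reflexive (cong (λ xs → f zero + sumR xs)
    (trans (List.map-tabulate suc f) (sym (List.map-tabulate id (f ∘ suc)))))

  ∑-allVecs-suc : ∀ {B : Set} (xs : List B) m (g : Vec B (suc m) → Carrier) →
    ∑ g (allVecs xs (suc m)) ≈ ∑ (λ x → ∑ (λ t → g (x ∷ t)) (allVecs xs m)) xs
  ∑-allVecs-suc xs m g = ≈-trans (∑-concatMap g (λ x → map (x ∷_) (allVecs xs m)) xs)
    (∑-cong xs (λ x → reflexive (∑-map g (x ∷_) (allVecs xs m))))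

pointsTo : ∀ {n} → Maybe (Fin n) → Fin n → Bool
pointsTo nothing   j = false
pointsTo (just j′) j = eqFin j′ j

pointsTo⇒≡just : ∀ {n} (x : Maybe (Fin n)) j → pointsTo x j ≡ true → x ≡ just j
pointsTo⇒≡just (just j′) j e = cong just (eqFin⇒≡ j′ j e)

edge-pointsTo : ∀ {n} (σ : SuccMap n) i j → edge σ i j ≡ pointsTo (lookup σ i) j
edge-pointsTo σ i j with lookup σ i
... | nothing = refl
... | just _  = refl

reachesIn-pointsTo : ∀ {n} (σ : SuccMap n) m i j → reachesIn σ m i j ≡ pointsTo (iter σ m i) j
reachesIn-pointsTo σ m i j with iter σ m i
... | nothing = refl
... | just _  = refl

edge⇒lookup : ∀ {n} (σ : SuccMap n) i j → edge σ i j ≡ true → lookup σ i ≡ just j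
edge⇒lookup σ i j e = pointsTo⇒≡just _ j (trans (sym (edge-pointsTo σ i j)) e)

lookup⇒edge : ∀ {n} (σ : SuccMap n) i j → lookup σ i ≡ just j → edge σ i j ≡ true
lookup⇒edge σ i j e = trans (edge-pointsTo σ i j) (trans (cong (λ x → pointsTo x j) e) (eqFin-refl j))

reachesIn⇒iter : ∀ {n} (σ : SuccMap n) m i j → reachesIn σ m i j ≡ true → iter σ m i ≡ just j
reachesIn⇒iter σ m i j e = pointsTo⇒≡just _ j (trans (sym (reachesIn-pointsTo σ m i j)) e)

iter⇒reachesIn : ∀ {n} (σ : SuccMap n) m i j → iter σ m i ≡ just j → reachesIn σ m i j ≡ true
iter⇒reachesIn σ m i j e = trans (reachesIn-pointsTo σ m i j) (trans (cong (λ x → pointsTo x j) e) (eqFin-refl j))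

lookup⇒hasPred : ∀ {n} (σ : SuccMap n) i j → lookup σ i ≡ just j → hasPred σ j ≡ true
lookup⇒hasPred σ i j e = ⇒anyB-allFin (λ k → edge σ k j) i (lookup⇒edge σ i j e)

IsLaguerre : ∀ {n} → SuccMap n → Set
IsLaguerre σ = ∀ a b c → lookup σ a ≡ just c → lookup σ b ≡ just c → a ≡ b

isLaguerre⇒IsLaguerre : ∀ {n} (σ : SuccMap n) → isLaguerre σ ≡ true → IsLaguerre σ
isLaguerre⇒IsLaguerre σ e a b c ea eb =
  eqFin⇒≡ a b (subst (λ x → not x ∨ eqFin a b ≡ true)
                     (cong₂ _∧_ (lookup⇒edge σ a c ea) (lookup⇒edge σ b c eb))
                     (allB-allFin⇒ _ (allB-allFin⇒ _ (allB-allFin⇒ _ e c) a) b))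

IsLaguerre⇒isLaguerre : ∀ {n} (σ : SuccMap n) → IsLaguerre σ → isLaguerre σ ≡ true
IsLaguerre⇒isLaguerre σ L = ⇒allB-allFin _ λ c → ⇒allB-allFin _ λ a → ⇒allB-allFin _ λ b → atMostOnePred c a b
  where
  atMostOnePred : ∀ c a b → not (edge σ a c ∧ edge σ b c) ∨ eqFin a b ≡ true
  atMostOnePred c a b with edge σ a c in ea | edge σ b c in eb
  ... | false | _     = refl
  ... | true  | false = refl
  ... | true  | true  = subst (λ x → eqFin a x ≡ true) (L a b c (edge⇒lookup σ a c ea) (edge⇒lookup σ b c eb)) (eqFin-refl a)

advance : ∀ {n} → SuccMap n → Maybe (Fin n) → Maybe (Fin n)
advance σ nothing  = nothing
advance σ (just j) = lookup σ j

iter-suc : ∀ {n} (σ : SuccMap n) m i → iter σ (suc m) i ≡ advance σ (iter σ m i)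
iter-suc σ m i with iter σ m i
... | nothing = refl
... | just _  = refl

iter-nothing-≤ : ∀ {n} (σ : SuccMap n) {a b} i → a ≤ b → iter σ a i ≡ nothing → iter σ b i ≡ nothing
iter-nothing-≤ σ {b = zero}  i z≤n e = e
iter-nothing-≤ σ {b = suc b} i le e with m≤n⇒m<n∨m≡n le
... | inj₂ refl     = e
... | inj₁ (s≤s lt) = trans (iter-suc σ b i) (cong (advance σ) (iter-nothing-≤ σ i lt e))

iter-+ : ∀ {n} (σ : SuccMap n) a b i y → iter σ b i ≡ just y → iter σ (a ℕ.+ b) i ≡ iter σ a y
iter-+ σ zero    b i y e = e
iter-+ σ (suc a) b i y e =
  trans (iter-suc σ (a ℕ.+ b) i) (trans (cong (advance σ) (iter-+ σ a b i y e)) (sym (iter-suc σ a y)))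

iter-suc-first : ∀ {n} (σ : SuccMap n) m i j → lookup σ i ≡ just j → iter σ (suc m) i ≡ iter σ m j
iter-suc-first σ m i j e = trans (cong (λ k → iter σ k i) (ℕₚ.+-comm 1 m)) (iter-+ σ m 1 i j e)

iter-suc-stuck : ∀ {n} (σ : SuccMap n) m i → lookup σ i ≡ nothing → iter σ (suc m) i ≡ nothing
iter-suc-stuck σ m i e = iter-nothing-≤ σ {1} {suc m} i (s≤s z≤n) e

iter-suc-last : ∀ {n} (σ : SuccMap n) m i v → iter σ (suc m) i ≡ just v →
  ∃ λ u → iter σ m i ≡ just u × lookup σ u ≡ just v
iter-suc-last σ m i v e with iter σ m i | iter-suc σ m i
... | just u | eq = u , refl , trans (sym eq) e

iter-injective : ∀ {n} (σ : SuccMap n) → IsLaguerre σ → ∀ m x y v → iter σ m x ≡ just v → iter σ m y ≡ just v → x ≡ y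
iter-injective σ L zero    x y v ex ey = trans (just-injective ex) (sym (just-injective ey))
iter-injective σ L (suc m) x y v ex ey with iter-suc-last σ m x v ex | iter-suc-last σ m y v ey
... | x′ , ix , lx | y′ , iy , ly = iter-injective σ L m x y x′ ix (trans iy (cong just (sym (L x′ y′ v lx ly))))

OnCycle : ∀ {n} → SuccMap n → Fin n → Set
OnCycle σ i = ∃ λ p → 1 ≤ p × iter σ p i ≡ just i

IsCycleMin : ∀ {n} → SuccMap n → Fin n → Set
IsCycleMin σ i = ∀ m j → iter σ m i ≡ just j → toℕ i ≤ toℕ j

-- Pigeonhole on the n + 1 points i, σ i, …, σⁿ i; injectivity of σ then pulls a repetition back to i.
iter-returns : ∀ {n} (σ : SuccMap n) → IsLaguerre σ → ∀ i → (∀ m → m ≤ n → iter σ m i ≢ nothing) →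
  ∃ λ q → 1 ≤ q × q ≤ n × iter σ q i ≡ just i
iter-returns {n} σ L i defined with pigeonhole (n<1+n n) (λ k → fromMaybe i (iter σ (toℕ k) i))
... | a , b , a<b , same = d , m<n⇒0<n∸m a<b , d≤n , trans iter-d (cong just y≡i)
  where
  isJust : ∀ m → m ≤ n → iter σ m i ≡ just (fromMaybe i (iter σ m i))
  isJust m m≤n with iter σ m i | defined m m≤n
  ... | nothing | undef = ⊥-elim (undef refl)
  ... | just _  | _     = refl
  B≤n = ≤-pred (toℕ<n b)
  A≤n = ≤-trans (<⇒≤ a<b) B≤n
  d = toℕ b ∸ toℕ a
  d≤n = ≤-trans (m∸n≤m (toℕ b) (toℕ a)) B≤n
  y = fromMaybe i (iter σ d i)
  iter-d = isJust d d≤n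
  y≡i : y ≡ i
  y≡i = iter-injective σ L (toℕ a) y i _
    (trans (sym (iter-+ σ (toℕ a) d i y iter-d))
      (trans (cong (λ k → iter σ k i) (m+[n∸m]≡n (<⇒≤ a<b))) (trans (isJust (toℕ b) B≤n) (cong just (sym same)))))
    (isJust (toℕ a) A≤n)

iter-mod-period : ∀ {n} (σ : SuccMap n) i p → 1 ≤ p → iter σ p i ≡ just i →
  ∀ m → ∃ λ r → r < p × iter σ (suc m) i ≡ iter σ (suc r) i
iter-mod-period σ i p 1≤p e zero = zero , 1≤p , refl
iter-mod-period σ i p 1≤p e (suc m) with iter-mod-period σ i p 1≤p e m
... | r , r<p , h with m≤n⇒m<n∨m≡n r<p
...   | inj₁ lt = suc r , lt , trans (iter-suc σ (suc m) i) (trans (cong (advance σ) h) (sym (iter-suc σ (suc r) i)))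
...   | inj₂ eq = zero , 1≤p ,
          trans (iter-suc σ (suc m) i) (cong (advance σ) (trans h (trans (cong (λ k → iter σ k i) eq) e)))

OnCycle⇒iter-defined : ∀ {n} (σ : SuccMap n) i → OnCycle σ i → ∀ m → iter σ m i ≢ nothing
OnCycle⇒iter-defined σ i (p , 1≤p , e) (suc m) h with iter-mod-period σ i p 1≤p e m
... | r , r<p , h′ with trans (sym e) (iter-nothing-≤ σ {suc r} {p} i r<p (trans (sym h′) h))
...   | ()

<ᵇ-suc⇒≤ : ∀ a b → (a <ᵇ suc b) ≡ true → a ≤ b
<ᵇ-suc⇒≤ zero    b       _ = z≤n
<ᵇ-suc⇒≤ (suc a) (suc b) e = s≤s (<ᵇ-suc⇒≤ a b e)

≤⇒<ᵇ-suc : ∀ {a b} → a ≤ b → (a <ᵇ suc b) ≡ true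
≤⇒<ᵇ-suc z≤n      = refl
≤⇒<ᵇ-suc (s≤s le) = ≤⇒<ᵇ-suc le

cycleRep-sound : ∀ {n} (σ : SuccMap n) i → cycleRep σ i ≡ true → OnCycle σ i × IsCycleMin σ i
cycleRep-sound {n} σ i e with anyB-applyUpTo⇒ n id _ (∧-conicalˡ _ _ e)
... | m , m<n , hm = (suc m , s≤s z≤n , period) , minimal
  where
  period = reachesIn⇒iter σ (suc m) i i hm
  minimal : IsCycleMin σ i
  minimal zero    j ej = subst (λ x → toℕ i ≤ toℕ x) (just-injective ej) ≤-refl
  minimal (suc k) j ej with iter-mod-period σ i (suc m) (s≤s z≤n) period k
  ... | r , r<p , h =
    <ᵇ-suc⇒≤ (toℕ i) (toℕ j)
      (subst (λ x → not x ∨ (toℕ i <ᵇ suc (toℕ j)) ≡ true) (iter⇒reachesIn σ (suc r) i j (trans (sym h) ej))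
        (allB-allFin⇒ _ (allB-applyUpTo⇒ n id _ (∧-conicalʳ (onCycle σ i) _ e) r (<-≤-trans r<p m<n)) j))

cycleRep-complete : ∀ {n} (σ : SuccMap n) → IsLaguerre σ → ∀ i → OnCycle σ i → IsCycleMin σ i → cycleRep σ i ≡ true
cycleRep-complete {n} σ L i cyc min with iter-returns σ L i (λ m _ → OnCycle⇒iter-defined σ i cyc m)
... | suc q , _ , q<n , eq =
  ∧-intro (⇒anyB-applyUpTo n id _ q q<n (iter⇒reachesIn σ (suc q) i i eq))
          (⇒allB-applyUpTo n id _ λ m _ → ⇒allB-allFin _ λ j → minimal m j)
  where
  minimal : ∀ m j → not (reachesIn σ (suc m) i j) ∨ (toℕ i <ᵇ suc (toℕ j)) ≡ true
  minimal m j with reachesIn σ (suc m) i j in r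
  ... | false = refl
  ... | true  = ≤⇒<ᵇ-suc (min (suc m) j (reachesIn⇒iter σ (suc m) i j r))

reachable : ∀ {n} → SuccMap n → Fin n → Fin n → Bool
reachable {n} σ w u = anyB (λ m → reachesIn σ m w u) (upTo n)

reachable⇒ : ∀ {n} (σ : SuccMap n) w u → reachable σ w u ≡ true → ∃ λ m → m < n × iter σ m w ≡ just u
reachable⇒ {n} σ w u e with anyB-applyUpTo⇒ n id _ e
... | m , lt , h = m , lt , reachesIn⇒iter σ m w u h

⇒reachable : ∀ {n} (σ : SuccMap n) w u m → m < n → iter σ m w ≡ just u → reachable σ w u ≡ true
⇒reachable {n} σ w u m lt e = ⇒anyB-applyUpTo n id _ m lt (iter⇒reachesIn σ m w u e)

iter-lastDefined : ∀ {n} (σ : SuccMap n) w m → iter σ m w ≡ nothing →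
  ∃ λ r → r < m × ∃ λ u → iter σ r w ≡ just u × lookup σ u ≡ nothing
iter-lastDefined σ w (suc m) e with iter σ m w in im
... | nothing = let (r , lt , u , h₁ , h₂) = iter-lastDefined σ w m im in r , <-trans lt (n<1+n m) , u , h₁ , h₂
... | just u  = m , n<1+n m , u , im , e

-- A vertex without predecessor cannot lie on a cycle, so by iter-returns its orbit dies within n steps.
pathStart-terminates : ∀ {n} (σ : SuccMap n) → IsLaguerre σ → ∀ w → hasPred σ w ≡ false → iter σ n w ≡ nothing
pathStart-terminates {n} σ L w noPred with iter σ n w in e
... | nothing = refl
... | just _ with iter-returns σ L w (λ m m≤n h → just≢nothing (trans (sym e) (iter-nothing-≤ σ w m≤n h)))
...   | suc q , _ , _ , eq with iter-suc-last σ q w w eq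
...     | x , _ , lx = ⊥-elim (true≢false (trans (sym (lookup⇒hasPred σ x w lx)) noPred))

pathStart-uniqueEnd : ∀ {n} (σ : SuccMap n) → IsLaguerre σ → ∀ w → hasPred σ w ≡ false →
  countB (λ u → is-nothing (lookup σ u) ∧ reachable σ w u) (allFin n) ≡ 1
pathStart-uniqueEnd {n} σ L w noPred with iter-lastDefined σ w n (pathStart-terminates σ L w noPred)
... | r , r<n , u , ru , su = countB-unique _ unique u (∧-intro (cong is-nothing su) (⇒reachable σ w u r r<n ru))
  where
  isEnd : ∀ {u} → is-nothing (lookup σ u) ≡ true → lookup σ u ≡ nothing
  isEnd {u} e with lookup σ u
  ... | nothing = refl
  beyondEnd : ∀ {r s u v} → r < s → iter σ r w ≡ just u → is-nothing (lookup σ u) ≡ true → iter σ s w ≢ just v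
  beyondEnd {r} lt hu eu hv with trans (sym hv) (iter-nothing-≤ σ w lt (trans (iter-suc σ r w) (trans (cong (advance σ) hu) (isEnd eu))))
  ... | ()
  unique : ∀ a b → is-nothing (lookup σ a) ∧ reachable σ w a ≡ true → is-nothing (lookup σ b) ∧ reachable σ w b ≡ true → a ≡ b
  unique a b ea eb with reachable⇒ σ w a (∧-conicalʳ _ _ ea) | reachable⇒ σ w b (∧-conicalʳ _ _ eb)
  ... | r₁ , _ , h₁ | r₂ , _ , h₂ with <-cmp r₁ r₂
  ...   | tri< lt _ _    = ⊥-elim (beyondEnd lt h₁ (∧-conicalˡ _ _ ea) h₂)
  ...   | tri≈ _ refl _  = just-injective (trans (sym h₁) h₂)
  ...   | tri> _ _ gt    = ⊥-elim (beyondEnd gt h₂ (∧-conicalˡ _ _ eb) h₁)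

indicator : Bool → ℕ
indicator b = if b then 1 else 0

open Sums ℕₚ.+-*-commutativeSemiring using () renaming (∑ to ∑ℕ; ∑-cong to ∑ℕ-cong; ∑-swap to ∑ℕ-swap)

countB≡∑ℕ : ∀ {A : Set} (p : A → Bool) xs → countB p xs ≡ ∑ℕ (indicator ∘ p) xs
countB≡∑ℕ p []       = refl
countB≡∑ℕ p (x ∷ xs) with p x
... | true  = cong suc (countB≡∑ℕ p xs)
... | false = countB≡∑ℕ p xs

outDegree : ∀ {n} (σ : SuccMap n) u → countB (edge σ u) (allFin n) ≡ indicator (not (is-nothing (lookup σ u)))
outDegree {n} σ u =
  trans (countB-atMostOne _ (λ a b ea eb → just-injective (trans (sym (edge⇒lookup σ u a ea)) (edge⇒lookup σ u b eb))))
        (cong indicator (hasTarget (lookup σ u) refl))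
  where
  hasTarget : ∀ x → lookup σ u ≡ x → anyB (edge σ u) (allFin n) ≡ not (is-nothing x)
  hasTarget nothing  e = anyB-allFin-none _ λ v → trans (edge-pointsTo σ u v) (cong (λ y → pointsTo y v) e)
  hasTarget (just v) e = ⇒anyB-allFin _ v (lookup⇒edge σ u v e)

inDegree : ∀ {n} (σ : SuccMap n) → IsLaguerre σ → ∀ v → countB (λ u → edge σ u v) (allFin n) ≡ indicator (hasPred σ v)
inDegree σ L v = countB-atMostOne _ λ a b ea eb → L a b v (edge⇒lookup σ a v ea) (edge⇒lookup σ b v eb)

-- Double counting of edges: vertices with a successor are as many as vertices with a predecessor.
#ends≡#starts : ∀ {n} (σ : SuccMap n) → IsLaguerre σ →
  countB (λ u → is-nothing (lookup σ u)) (allFin n) ≡ countB (λ w → not (hasPred σ w)) (allFin n)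
#ends≡#starts {n} σ L = ℕₚ.+-cancelʳ-≡ _ _ _ (begin
  countB ends V ℕ.+ countB (not ∘ ends) V      ≡⟨ countB-+-countB-not ends V ⟩
  length V                                     ≡⟨ sym (countB-+-countB-not starts V) ⟩
  countB starts V ℕ.+ countB (not ∘ starts) V  ≡⟨ cong (countB starts V ℕ.+_) (sym #edges) ⟩
  countB starts V ℕ.+ countB (not ∘ ends) V    ∎)
  where
  open ≡-Reasoning
  V = allFin n
  ends   = λ u → is-nothing (lookup σ u)
  starts = λ w → not (hasPred σ w)
  #edges : countB (not ∘ ends) V ≡ countB (not ∘ starts) V
  #edges = begin
    countB (not ∘ ends) V                                  ≡⟨ countB≡∑ℕ _ V ⟩
    ∑ℕ (indicator ∘ not ∘ ends) V
      ≡⟨ ∑ℕ-cong V (λ u → trans (sym (outDegree σ u)) (countB≡∑ℕ (edge σ u) V)) ⟩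
    ∑ℕ (λ u → ∑ℕ (λ v → indicator (edge σ u v)) V) V      ≡⟨ ∑ℕ-swap (λ u v → indicator (edge σ u v)) V V ⟩
    ∑ℕ (λ v → ∑ℕ (λ u → indicator (edge σ u v)) V) V
      ≡⟨ ∑ℕ-cong V (λ v → trans (sym (countB≡∑ℕ _ V)) (inDegree σ L v)) ⟩
    ∑ℕ (indicator ∘ hasPred σ) V                           ≡⟨ sym (countB≡∑ℕ _ V) ⟩
    countB (hasPred σ) V                                   ≡⟨ countB-cong V (λ x → sym (not-involutive (hasPred σ x))) ⟩
    countB (not ∘ starts) V                                ∎

shiftLabel : ℕ → ℕ
shiftLabel zero    = zero
shiftLabel (suc a) = suc (suc a)

labelOf : ∀ {n} → Maybe (Fin n) → ℕ
labelOf nothing  = 0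
labelOf (just j) = lab j

labelOf-map-suc : ∀ {n} (y : Maybe (Fin n)) → labelOf (Maybe.map suc y) ≡ shiftLabel (labelOf y)
labelOf-map-suc nothing  = refl
labelOf-map-suc (just _) = refl

sLab≡labelOf : ∀ {n} (σ : SuccMap n) i → sLab σ i ≡ labelOf (lookup σ i)
sLab≡labelOf σ i with lookup σ i
... | nothing = refl
... | just _  = refl

firstLabel : ∀ {n} → (Fin n → Bool) → List (Fin n) → ℕ
firstLabel p = foldr (λ j r → if p j then lab j else r) 0

firstLabel-shift : ∀ {n} (p : Fin n → Bool) xs →
  foldr (λ j r → if p j then lab (Fin.suc j) else r) 0 xs ≡ shiftLabel (firstLabel p xs)
firstLabel-shift p []       = refl
firstLabel-shift p (x ∷ xs) with p x
... | true  = refl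
... | false = firstLabel-shift p xs

firstLabel-allFin-suc : ∀ {n} (p : Fin (suc n) → Bool) →
  firstLabel p (allFin (suc n)) ≡ (if p zero then 1 else shiftLabel (firstLabel (p ∘ suc) (allFin n)))
firstLabel-allFin-suc {n} p =
  trans (foldr-allFin-suc (λ j r → if p j then lab j else r) 0)
        (cong (if p zero then 1 else_) (firstLabel-shift (p ∘ suc) (allFin n)))

firstLabel-none : ∀ {n} (p : Fin n → Bool) → (∀ j → p j ≡ false) → firstLabel p (allFin n) ≡ 0
firstLabel-none {zero}  p h = refl
firstLabel-none {suc n} p h rewrite firstLabel-allFin-suc p | h zero = cong shiftLabel (firstLabel-none (p ∘ suc) (h ∘ suc))

firstLabel-some : ∀ {n} (p : Fin n → Bool) j → p j ≡ true → ∃ λ k → firstLabel p (allFin n) ≡ suc k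
firstLabel-some {suc n} p j e rewrite firstLabel-allFin-suc p with p zero in e₀ | j
... | true  | _      = 0 , refl
... | false | zero   = ⊥-elim (true≢false (trans (sym e) e₀))
... | false | suc j′ with firstLabel-some (p ∘ suc) j′ e
...   | k , h = suc k , cong shiftLabel h

noPred⇒pLab≡0 : ∀ {n} (σ : SuccMap n) c → hasPred σ c ≡ false → pLab σ c ≡ 0
noPred⇒pLab≡0 σ c h = firstLabel-none _ λ j → ¬-not λ e → true≢false (trans (sym (⇒anyB-allFin (λ j → edge σ j c) j e)) h)

badTriple : ℕ → ℕ → ℕ → Bool
badTriple p l s = ((p <ᵇ l) ∧ (l <ᵇ s)) ∨ ((l <ᵇ p) ∧ (s <ᵇ l)) ∨ ((p ≡ᵇ l) ∧ (l ≡ᵇ s))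

isBad : ∀ {n} → SuccMap n → Fin n → Bool
isBad σ i = isDoubleAscent σ i ∨ isDoubleDescent σ i ∨ isFixedPoint σ i

-- A neighbour label P of vertex l + 2 in the bigger graph, against p for vertex l + 1 in the smaller one:
-- either shifted by one, or a former boundary 0 now pointing at the new vertex 1.
ShiftedLabel : ℕ → ℕ → Set
ShiftedLabel p P = P ≡ shiftLabel p ⊎ (p ≡ 0 × P ≡ 1)

badTriple-shift : ∀ p P q Q l → ShiftedLabel p P → ShiftedLabel q Q → badTriple P (suc (suc l)) Q ≡ badTriple p (suc l) q
badTriple-shift zero    _ zero    _ l (inj₁ refl)       (inj₁ refl)       = refl
badTriple-shift zero    _ zero    _ l (inj₁ refl)       (inj₂ (_ , refl)) = refl
badTriple-shift zero    _ zero    _ l (inj₂ (_ , refl)) (inj₁ refl)       = refl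
badTriple-shift zero    _ zero    _ l (inj₂ (_ , refl)) (inj₂ (_ , refl)) = refl
badTriple-shift zero    _ (suc q) _ l (inj₁ refl)       (inj₁ refl)       = refl
badTriple-shift zero    _ (suc q) _ l (inj₂ (_ , refl)) (inj₁ refl)       = refl
badTriple-shift (suc p) _ zero    _ l (inj₁ refl)       (inj₁ refl)       = refl
badTriple-shift (suc p) _ zero    _ l (inj₁ refl)       (inj₂ (_ , refl)) = refl
badTriple-shift (suc p) _ (suc q) _ l (inj₁ refl)       (inj₁ refl)       = refl
badTriple-shift _       _ (suc q) _ l _                 (inj₂ (() , _))
badTriple-shift (suc p) _ _       _ l (inj₂ (() , _))   _

shift : ∀ {n m} → Vec (Maybe (Fin n)) m → Vec (Maybe (Fin (suc n))) m
shift = Vec.map (Maybe.map suc)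

redirect : ∀ {n} → SuccMap n → Maybe (Fin n) → Vec (Maybe (Fin (suc n))) n
redirect s nothing  = shift s
redirect s (just u) = shift s [ u ]≔ just zero

-- insertMin x s mu is the digraph on [n + 1] whose vertex 1 has successor x and predecessor mu,
-- the old vertices being relabelled i ↦ i + 1.
insertMin : ∀ {n} → Maybe (Fin (suc n)) → SuccMap n → Maybe (Fin n) → SuccMap (suc n)
insertMin x s mu = x ∷ redirect s mu

redirected : ∀ {n} → Maybe (Fin n) → SuccMap n → Fin n → Maybe (Fin (suc n))
redirected nothing  s a = Maybe.map suc (lookup s a)
redirected (just u) s a = if eqFin u a then just zero else Maybe.map suc (lookup s a)

lookup-redirect : ∀ {n} (s : SuccMap n) mu a → lookup (redirect s mu) a ≡ redirected mu s a
lookup-redirect s nothing  a = lookup-map a (Maybe.map suc) s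
lookup-redirect s (just u) a with eqFin u a in e
... | true  rewrite eqFin⇒≡ u a e = lookup∘update a (shift s) (just zero)
... | false = trans (lookup∘update′ (λ { refl → true≢false (trans (sym (eqFin-refl a)) e) }) (shift s) (just zero))
                    (lookup-map a (Maybe.map suc) s)

FreeEnd : ∀ {n} → SuccMap n → Maybe (Fin n) → Set
FreeEnd s nothing  = ⊤
FreeEnd s (just u) = lookup s u ≡ nothing

module InsertMin {n : ℕ} (x : Maybe (Fin (suc n))) (s : SuccMap n) (mu : Maybe (Fin n)) (free : FreeEnd s mu) where

  σ : SuccMap (suc n)
  σ = insertMin x s mu

  lookup-suc : ∀ a → lookup σ (suc a) ≡ redirected mu s a
  lookup-suc = lookup-redirect s mu

  lookup-suc-just : ∀ a b → lookup s a ≡ just b → lookup σ (suc a) ≡ just (suc b)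
  lookup-suc-just a b e = trans (lookup-suc a) (redirected-just mu free)
    where
    redirected-just : ∀ mu → FreeEnd s mu → redirected mu s a ≡ just (suc b)
    redirected-just nothing  _ = cong (Maybe.map suc) e
    redirected-just (just u) f with eqFin u a in eu
    ... | true  = ⊥-elim (just≢nothing (trans (sym e) (subst (λ k → lookup s k ≡ nothing) (eqFin⇒≡ u a eu) f)))
    ... | false = cong (Maybe.map suc) e

  lookup-suc-cases : ∀ a c → lookup σ (suc a) ≡ just c →
    (c ≡ zero × mu ≡ just a) ⊎ (∃ λ c′ → c ≡ suc c′ × lookup s a ≡ just c′)
  lookup-suc-cases a c e = cases mu (trans (sym (lookup-suc a)) e)
    where
    shifted : ∀ y → lookup s a ≡ y → Maybe.map suc y ≡ just c → ∃ λ c′ → c ≡ suc c′ × lookup s a ≡ just c′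
    shifted (just c′) ey refl = c′ , refl , ey
    cases : ∀ m → redirected m s a ≡ just c → (c ≡ zero × m ≡ just a) ⊎ (∃ λ c′ → c ≡ suc c′ × lookup s a ≡ just c′)
    cases nothing  h = inj₂ (shifted (lookup s a) refl h)
    cases (just u) h with eqFin u a in eu
    ... | true  = inj₁ (sym (just-injective h) , cong just (eqFin⇒≡ u a eu))
    ... | false = inj₂ (shifted (lookup s a) refl h)

  lookup-suc-suc : ∀ a b → lookup σ (suc a) ≡ just (suc b) → lookup s a ≡ just b
  lookup-suc-suc a b e with lookup-suc-cases a (suc b) e
  ... | inj₂ (c′ , eq , h) = trans h (cong just (sym (suc-injective eq)))

  edge-suc-suc : ∀ a c → edge σ (suc a) (suc c) ≡ edge s a c
  edge-suc-suc a c = bool-ext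
    (λ e → lookup⇒edge s a c (lookup-suc-suc a c (edge⇒lookup σ (suc a) (suc c) e)))
    (λ e → lookup⇒edge σ (suc a) (suc c) (lookup-suc-just a c (edge⇒lookup s a c e)))

  edge-suc-zero : ∀ a → edge σ (suc a) zero ≡ pointsTo mu a
  edge-suc-zero a = trans (edge-pointsTo σ (suc a) zero) (trans (cong (λ y → pointsTo y zero) (lookup-suc a)) (cases mu))
    where
    lifted : ∀ (y : Maybe (Fin n)) → pointsTo (Maybe.map suc y) zero ≡ false
    lifted nothing  = refl
    lifted (just _) = refl
    cases : ∀ m → pointsTo (redirected m s a) zero ≡ pointsTo m a
    cases nothing = lifted (lookup s a)
    cases (just u) with eqFin u a
    ... | true  = refl
    ... | false = lifted (lookup s a)

  hasPred-suc : ∀ c → hasPred σ (suc c) ≡ (pointsTo x (suc c) ∨ hasPred s c)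
  hasPred-suc c = trans (anyB-allFin-suc (λ j → edge σ j (suc c)))
    (cong₂ _∨_ (edge-pointsTo σ zero (suc c)) (anyB-cong (allFin n) (λ a → edge-suc-suc a c)))

  hasPred-zero : hasPred σ zero ≡ (pointsTo x zero ∨ anyB (pointsTo mu) (allFin n))
  hasPred-zero = trans (anyB-allFin-suc (λ j → edge σ j zero))
    (cong₂ _∨_ (edge-pointsTo σ zero zero) (anyB-cong (allFin n) edge-suc-zero))

  pLab-suc : ∀ c → pLab σ (suc c) ≡ (if pointsTo x (suc c) then 1 else shiftLabel (pLab s c))
  pLab-suc c = trans (firstLabel-allFin-suc (λ j → edge σ j (suc c)))
    (cong₂ (λ b t → if b then 1 else shiftLabel t) (edge-pointsTo σ zero (suc c))
           (foldr-cong 0 (allFin n) (λ a r → cong (λ b → if b then lab a else r) (edge-suc-suc a c))))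

  pLab-zero : pLab σ zero ≡ (if pointsTo x zero then 1 else shiftLabel (firstLabel (pointsTo mu) (allFin n)))
  pLab-zero = trans (firstLabel-allFin-suc (λ j → edge σ j zero))
    (cong₂ (λ b t → if b then 1 else shiftLabel t) (edge-pointsTo σ zero zero)
           (foldr-cong 0 (allFin n) (λ a r → cong (λ b → if b then lab a else r) (edge-suc-zero a))))

  pLab-shifted : ∀ c → (pointsTo x (suc c) ≡ true → hasPred s c ≡ false) → ShiftedLabel (pLab s c) (pLab σ (suc c))
  pLab-shifted c h with pointsTo x (suc c) in e
  ... | true  = inj₂ (noPred⇒pLab≡0 s c (h refl) , trans (pLab-suc c) (cong (λ b → if b then 1 else _) e))
  ... | false = inj₁ (trans (pLab-suc c) (cong (λ b → if b then 1 else _) e))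

  sLab-shifted : ∀ c → ShiftedLabel (sLab s c) (sLab σ (suc c))
  sLab-shifted c rewrite sLab≡labelOf σ (suc c) | lookup-suc c | sLab≡labelOf s c = cases mu free
    where
    cases : ∀ m → FreeEnd s m → ShiftedLabel (labelOf (lookup s c)) (labelOf (redirected m s c))
    cases nothing  _ = inj₁ (labelOf-map-suc (lookup s c))
    cases (just u) f with eqFin u c in eu
    ... | true  = inj₂ (cong labelOf (subst (λ k → lookup s k ≡ nothing) (eqFin⇒≡ u c eu) f) , refl)
    ... | false = inj₁ (labelOf-map-suc (lookup s c))

  isAlternating-insertMin : (∀ c → pointsTo x (suc c) ≡ true → hasPred s c ≡ false) →
    isAlternating σ ≡ (not (isBad σ zero) ∧ isAlternating s)
  isAlternating-insertMin h = trans (allB-allFin-suc (not ∘ isBad σ))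
    (cong (not (isBad σ zero) ∧_) (allB-cong (allFin n)
      (λ c → cong not (badTriple-shift _ _ _ _ (toℕ c) (pLab-shifted c (h c)) (sLab-shifted c)))))

  isBad-zero⇒¬alternating : isBad σ zero ≡ true → isAlternating σ ≡ false
  isBad-zero⇒¬alternating e =
    trans (allB-allFin-suc (not ∘ isBad σ)) (cong (λ b → not b ∧ allB (not ∘ isBad σ ∘ suc) (allFin n)) e)

  numPaths-insertMin : numPaths σ ≡
    (if not (hasPred σ zero) then suc (countB (λ c → not (pointsTo x (suc c) ∨ hasPred s c)) (allFin n))
                              else countB (λ c → not (pointsTo x (suc c) ∨ hasPred s c)) (allFin n))
  numPaths-insertMin = trans (countB-allFin-suc (not ∘ hasPred σ))
    (cong (λ t → if not (hasPred σ zero) then suc t else t) (countB-cong (allFin n) (λ c → cong not (hasPred-suc c))))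

  iter-lift : ∀ m v y → iter s m v ≡ just y → iter σ m (suc v) ≡ just (suc y)
  iter-lift zero    v y e = cong (just ∘ suc) (just-injective e)
  iter-lift (suc m) v y e with iter-suc-last s m v y e
  ... | v′ , iv , lv = trans (iter-suc σ m (suc v)) (trans (cong (advance σ) (iter-lift m v v′ iv)) (lookup-suc-just v′ y lv))

  iter-lower : ∀ v → (∀ m → iter σ m (suc v) ≢ just zero) → ∀ m y → iter σ m (suc v) ≡ just (suc y) → iter s m v ≡ just y
  iter-lower v avoids zero    y e = cong just (suc-injective (just-injective e))
  iter-lower v avoids (suc m) y e with iter-suc-last σ m (suc v) (suc y) e
  ... | zero   , iv , lv = ⊥-elim (avoids m iv)
  ... | suc v′ , iv , lv = trans (iter-suc s m v) (trans (cong (advance s) (iter-lower v avoids m v′ iv)) (lookup-suc-suc v′ y lv))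

  cycleRep-suc : IsLaguerre σ → IsLaguerre s → ∀ c → cycleRep σ (suc c) ≡ cycleRep s c
  cycleRep-suc Lσ Ls c = bool-ext lower lift
    where
    lower : cycleRep σ (suc c) ≡ true → cycleRep s c ≡ true
    lower e with cycleRep-sound σ (suc c) e
    ... | (p , 1≤p , period) , min =
      cycleRep-complete s Ls c (p , 1≤p , iter-lower c avoids p c period)
                        (λ m j ej → ≤-pred (min m (suc j) (iter-lift m c j ej)))
      where
      avoids : ∀ m → iter σ m (suc c) ≢ just zero
      avoids m e with min m zero e
      ... | ()
    lift : cycleRep s c ≡ true → cycleRep σ (suc c) ≡ true
    lift e with cycleRep-sound s c e
    ... | cyc@(p , 1≤p , period) , min = cycleRep-complete σ Lσ (suc c) (p , 1≤p , iter-lift p c c period) minσ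
      where
      minσ : IsCycleMin σ (suc c)
      minσ m J eJ with iter s m c in im
      ... | nothing = ⊥-elim (OnCycle⇒iter-defined s c cyc m im)
      ... | just y  = subst (λ k → suc (toℕ c) ≤ toℕ k) (just-injective (trans (sym (iter-lift m c y im)) eJ)) (s≤s (min m y im))

countB-not-remove : ∀ {n} (q : Fin n → Bool) w → q w ≡ false →
  suc (countB (λ c → not (eqFin w c ∨ q c)) (allFin n)) ≡ countB (not ∘ q) (allFin n)
countB-not-remove {suc n} q zero e
  rewrite countB-allFin-suc (λ c → not (eqFin {suc n} zero c ∨ q c)) | countB-allFin-suc (not ∘ q) | e = refl
countB-not-remove {suc n} q (suc w) e
  rewrite countB-allFin-suc (λ c → not (eqFin (suc w) c ∨ q c)) | countB-allFin-suc (not ∘ q)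
  with q zero
... | true  = countB-not-remove (q ∘ suc) w e
... | false = cong suc (countB-not-remove (q ∘ suc) w e)

cycleRep-stuck : ∀ {n} (σ : SuccMap n) i → lookup σ i ≡ nothing → cycleRep σ i ≡ false
cycleRep-stuck {n} σ i e = ¬-not λ h →
  let (m , _ , hm) = anyB-applyUpTo⇒ n id (λ m → reachesIn σ (suc m) i i) (∧-conicalˡ (onCycle σ i) _ h)
  in just≢nothing (trans (sym (reachesIn⇒iter σ (suc m) i i hm)) (iter-suc-stuck σ m i e))

module InsertIsolated {n : ℕ} (s : SuccMap n) where
  open InsertMin nothing s nothing tt

  isLaguerre-isolated : isLaguerre σ ≡ isLaguerre s
  isLaguerre-isolated = bool-ext (λ e → IsLaguerre⇒isLaguerre s (restrict (isLaguerre⇒IsLaguerre σ e)))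
                                 (λ e → IsLaguerre⇒isLaguerre σ (extend (isLaguerre⇒IsLaguerre s e)))
    where
    restrict : IsLaguerre σ → IsLaguerre s
    restrict L a b c ea eb = suc-injective (L (suc a) (suc b) (suc c) (lookup-suc-just a c ea) (lookup-suc-just b c eb))
    extend : IsLaguerre s → IsLaguerre σ
    extend L (suc a) (suc b) c ea eb with lookup-suc-cases a c ea | lookup-suc-cases b c eb
    ... | inj₂ (c₁ , q₁ , h₁) | inj₂ (c₂ , q₂ , h₂) =
      cong suc (L a b c₁ h₁ (trans h₂ (cong just (suc-injective (trans (sym q₂) q₁)))))

  isAlternating-isolated : isAlternating σ ≡ isAlternating s
  isAlternating-isolated = trans (isAlternating-insertMin (λ c ()))
    (cong (λ p → not (badTriple p 1 0) ∧ isAlternating s)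
          (trans pLab-zero (cong shiftLabel (firstLabel-none (pointsTo {n} nothing) (λ _ → refl)))))

  numPaths-isolated : numPaths σ ≡ suc (numPaths s)
  numPaths-isolated = trans numPaths-insertMin
    (cong (λ b → if not b then suc rest else rest) (trans hasPred-zero (anyB-allFin-none (pointsTo {n} nothing) (λ _ → refl))))
    where rest = countB (λ c → not (false ∨ hasPred s c)) (allFin n)

  cyc-isolated : isLaguerre σ ≡ true → cyc σ ≡ cyc s
  cyc-isolated e = trans (countB-allFin-suc (cycleRep σ))
    (trans (cong (λ b → if b then suc rest else rest) (cycleRep-stuck σ zero refl))
           (countB-cong (allFin n) (cycleRep-suc (isLaguerre⇒IsLaguerre σ e)
                                                 (isLaguerre⇒IsLaguerre s (trans (sym isLaguerre-isolated) e)))))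
    where rest = countB (cycleRep σ ∘ suc) (allFin n)

-- Vertex 1 has a predecessor but no successor: a double descent.
¬alternating-predOnly : ∀ {n} (s : SuccMap n) u (free : lookup s u ≡ nothing) → isAlternating (insertMin nothing s (just u)) ≡ false
¬alternating-predOnly s u free = isBad-zero⇒¬alternating
  (cong (λ p → badTriple p 1 0) (trans pLab-zero (cong shiftLabel (proj₂ (firstLabel-some (pointsTo (just u)) u (eqFin-refl u))))))
  where open InsertMin nothing s (just u) free

-- Vertex 1 carries a loop: a fixed point.
¬alternating-loop : ∀ {n} (s : SuccMap n) mu (free : FreeEnd s mu) → isAlternating (insertMin (just zero) s mu) ≡ false
¬alternating-loop s mu free = isBad-zero⇒¬alternating (cong (λ p → badTriple p 1 1) pLab-zero)
  where open InsertMin (just zero) s mu free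

-- Vertex 1 has a successor but no predecessor: a double ascent.
¬alternating-succOnly : ∀ {n} (s : SuccMap n) w → isAlternating (insertMin (just (suc w)) s nothing) ≡ false
¬alternating-succOnly {n} s w = isBad-zero⇒¬alternating
  (cong (λ p → badTriple p 1 (lab (suc w))) (trans pLab-zero (cong shiftLabel (firstLabel-none (pointsTo {n} nothing) (λ _ → refl)))))
  where open InsertMin (just (suc w)) s nothing tt

-- Vertex 1 is a valley u → 1 → w joining the end u of one path to the start w of another;
-- it closes a cycle exactly when w reaches u.
module InsertValley {n : ℕ} (s : SuccMap n) (w u : Fin n) (free : lookup s u ≡ nothing) where
  open InsertMin (just (suc w)) s (just u) free

  isLaguerre-valley : isLaguerre σ ≡ (isLaguerre s ∧ not (hasPred s w))
  isLaguerre-valley = bool-ext restrict extend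
    where
    restrict : isLaguerre σ ≡ true → (isLaguerre s ∧ not (hasPred s w)) ≡ true
    restrict e = ∧-intro (IsLaguerre⇒isLaguerre s λ a b c ea eb →
                           suc-injective (L (suc a) (suc b) (suc c) (lookup-suc-just a c ea) (lookup-suc-just b c eb)))
                         (cong not (¬-not λ hp → let (j , ej) = anyB-allFin⇒ _ hp in
                           0≢1+n (L zero (suc j) (suc w) refl (lookup-suc-just j w (edge⇒lookup s j w ej)))))
      where L = isLaguerre⇒IsLaguerre σ e
    extend : (isLaguerre s ∧ not (hasPred s w)) ≡ true → isLaguerre σ ≡ true
    extend e = IsLaguerre⇒isLaguerre σ L
      where
      Ls = isLaguerre⇒IsLaguerre s (∧-conicalˡ _ _ e)
      noPred : ∀ b → lookup s b ≢ just w
      noPred b h = true≢false (trans (sym (lookup⇒hasPred s b w h)) (not-injective (∧-conicalʳ (isLaguerre s) _ e)))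
      notBoth : ∀ b c → just (suc w) ≡ just c → lookup σ (suc b) ≢ just c
      notBoth b c ea eb with lookup-suc-cases b c eb
      ... | inj₁ (refl , _)        = 0≢1+n (just-injective (sym ea))
      ... | inj₂ (c′ , refl , h)   = noPred b (trans h (cong just (sym (suc-injective (just-injective ea)))))
      L : IsLaguerre σ
      L zero    zero    c _  _  = refl
      L zero    (suc b) c ea eb = ⊥-elim (notBoth b c ea eb)
      L (suc a) zero    c ea eb = ⊥-elim (notBoth a c eb ea)
      L (suc a) (suc b) c ea eb with lookup-suc-cases a c ea | lookup-suc-cases b c eb
      ... | inj₁ (_ , m₁)         | inj₁ (_ , m₂)         = cong suc (just-injective (trans (sym m₁) m₂))
      ... | inj₁ (refl , _)       | inj₂ (_ , () , _)
      ... | inj₂ (_ , () , _)     | inj₁ (refl , _)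
      ... | inj₂ (c₁ , q₁ , h₁)   | inj₂ (c₂ , q₂ , h₂)   =
        cong suc (Ls a b c₁ h₁ (trans h₂ (cong just (suc-injective (trans (sym q₂) q₁)))))

  module _ (lag : isLaguerre σ ≡ true) where

    isLaguerre-s : isLaguerre s ∧ not (hasPred s w) ≡ true
    isLaguerre-s = trans (sym isLaguerre-valley) lag

    noPred-w : hasPred s w ≡ false
    noPred-w = not-injective (∧-conicalʳ (isLaguerre s) _ isLaguerre-s)

    Ls : IsLaguerre s
    Ls = isLaguerre⇒IsLaguerre s (∧-conicalˡ _ _ isLaguerre-s)

    isAlternating-valley : isAlternating σ ≡ isAlternating s
    isAlternating-valley = trans (isAlternating-insertMin (λ c ec → subst (λ k → hasPred s k ≡ false) (eqFin⇒≡ w c ec) noPred-w))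
      (cong (λ p → not (badTriple p 1 (lab (suc w))) ∧ isAlternating s)
            (trans pLab-zero (cong shiftLabel (proj₂ (firstLabel-some (pointsTo (just u)) u (eqFin-refl u))))))

    numPaths-valley : suc (numPaths σ) ≡ numPaths s
    numPaths-valley = trans (cong suc (trans numPaths-insertMin (cong (λ b → if not b then suc rest else rest)
                                       (trans hasPred-zero (⇒anyB-allFin (pointsTo (just u)) u (eqFin-refl u))))))
                            (countB-not-remove (hasPred s) w noPred-w)
      where rest = countB (λ c → not (eqFin w c ∨ hasPred s c)) (allFin n)

    iter-hits-zero : ∀ q v → iter σ q (suc v) ≡ just zero → ∃ λ r → r < q × iter s r v ≡ just u
    iter-hits-zero (suc q) v h with lookup σ (suc v) in ev
    ... | nothing = ⊥-elim (just≢nothing (trans (sym h) (iter-suc-stuck σ q (suc v) ev)))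
    ... | just c with lookup-suc-cases v c ev
    ...   | inj₁ (_ , m)             = 0 , s≤s z≤n , cong just (just-injective (sym m))
    ...   | inj₂ (c′ , refl , hc) with iter-hits-zero q c′ (trans (sym (iter-suc-first σ q (suc v) (suc c′) ev)) h)
    ...     | r , lt , hr = suc r , s≤s lt , trans (iter-suc-first s r v c′ hc) hr

    cycleRep-zero : cycleRep σ zero ≡ reachable s w u
    cycleRep-zero = trans (cong (onCycle σ zero ∧_) minimal)
                          (trans (∧-identityʳ (onCycle σ zero)) (bool-ext closes closed))
      where
      minimal : allB (λ m → allB (λ j → not (reachesIn σ (suc m) zero j) ∨ (toℕ {suc n} zero <ᵇ suc (toℕ j)))
                                 (allFin (suc n))) (upTo (suc n)) ≡ true
      minimal = ⇒allB-applyUpTo (suc n) id _ (λ m _ → ⇒allB-allFin _ (λ j → ∨-introʳ {not (reachesIn σ (suc m) zero j)} refl))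
      closes : onCycle σ zero ≡ true → reachable s w u ≡ true
      closes e with anyB-applyUpTo⇒ (suc n) id (λ m → reachesIn σ (suc m) zero zero) e
      ... | m , s≤s m≤n , hm with iter-hits-zero m w (trans (sym (iter-suc-first σ m zero (suc w) refl))
                                                              (reachesIn⇒iter σ (suc m) zero zero hm))
      ...   | r , r<m , hr = ⇒reachable s w u r (<-≤-trans r<m m≤n) hr
      closed : reachable s w u ≡ true → onCycle σ zero ≡ true
      closed e with reachable⇒ s w u e
      ... | r , r<n , hr = ⇒anyB-applyUpTo (suc n) id (λ m → reachesIn σ (suc m) zero zero) (suc r) (s≤s r<n)
                             (iter⇒reachesIn σ (suc (suc r)) zero zero (trans (iter-suc-first σ (suc r) zero (suc w) refl) backTo1))
        where
        backTo1 : iter σ (suc r) (suc w) ≡ just zero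
        backTo1 = trans (iter-suc σ r (suc w)) (trans (cong (advance σ) (iter-lift r w u hr))
                    (trans (lookup-suc u) (cong (λ b → if b then just zero else Maybe.map suc (lookup s u)) (eqFin-refl u))))

    cyc-valley : cyc σ ≡ (if reachable s w u then suc (cyc s) else cyc s)
    cyc-valley = trans (countB-allFin-suc (cycleRep σ))
      (trans (cong (λ b → if b then suc rest else rest) cycleRep-zero)
             (cong (λ t → if reachable s w u then suc t else t)
                   (countB-cong (allFin n) (cycleRep-suc (isLaguerre⇒IsLaguerre σ lag) Ls))))
      where rest = countB (cycleRep σ ∘ suc) (allFin n)

module LatticePaths {c ℓ : Level} (R : CommutativeSemiring c ℓ) (β : ℕ → CommutativeSemiring.Carrier R) where
  open CommutativeSemiring R hiding (zero) renaming (refl to ≈-refl; sym to ≈-sym; trans to ≈-trans)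
  open Weights R
  open Sums R
  open import Relation.Binary.Reasoning.Setoid setoid
  open CommutativeSemigroupProperties +-commutativeSemigroup using () renaming (interchange to +-interchange)
  open CommutativeSemigroupProperties *-commutativeSemigroup using (x∙yz≈y∙xz)

  noLevel : ℕ → Carrier
  noLevel _ = 0#

  Jfrom : ℕ → ℕ → ℕ → Carrier
  Jfrom n h k = sumR (map (weightFrom β noLevel h) (filterB (validFrom h k) (allVecs allSteps n)))

  weightIfValid : ∀ {n} → ℕ → ℕ → Vec Step n → Carrier
  weightIfValid h k v = if validFrom h k v then weightFrom β noLevel h v else 0#

  Jfrom≈∑ : ∀ n h k → Jfrom n h k ≈ ∑ (weightIfValid h k) (allVecs allSteps n)
  Jfrom≈∑ n h k = ∑-filterB (weightFrom β noLevel h) (validFrom h k) (allVecs allSteps n)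

  firstFall : ℕ → ℕ → ℕ → Carrier
  firstFall n zero    k = 0#
  firstFall n (suc h) k = β (suc h) * Jfrom n h k

  lastRise : ℕ → ℕ → ℕ → Carrier
  lastRise n h zero    = 0#
  lastRise n h (suc k) = Jfrom n h k

  Jfrom-firstStep : ∀ n h k → Jfrom (suc n) h k ≈ Jfrom n (suc h) k + firstFall n h k
  Jfrom-firstStep n h k = begin
    Jfrom (suc n) h k                                              ≈⟨ Jfrom≈∑ (suc n) h k ⟩
    ∑ (weightIfValid h k) (allVecs allSteps (suc n))               ≈⟨ ∑-allVecs-suc allSteps n (weightIfValid h k) ⟩
    ∑ (after rise) V + (∑ (after fall) V + (∑ (after level) V + 0#))
      ≈⟨ +-cong (≈-sym (Jfrom≈∑ n (suc h) k))
                (+-cong (startFall h) (≈-trans (+-identityʳ _) (∑-zero V (λ v → levelFree (validFrom h k v))))) ⟩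
    Jfrom n (suc h) k + (firstFall n h k + 0#)                     ≈⟨ +-congˡ (+-identityʳ _) ⟩
    Jfrom n (suc h) k + firstFall n h k                            ∎
    where
    V = allVecs allSteps n
    after : Step → Vec Step n → Carrier
    after x v = weightIfValid h k (x ∷ v)
    levelFree : ∀ b {x} → (if b then 0# * x else 0#) ≈ 0#
    levelFree true  = zeroˡ _
    levelFree false = ≈-refl
    scaled : ∀ b {k x} → (if b then k * x else 0#) ≈ k * (if b then x else 0#)
    scaled true  = ≈-refl
    scaled false = ≈-sym (zeroʳ _)
    startFall : ∀ h → ∑ (λ v → weightIfValid h k (fall ∷ v)) V ≈ firstFall n h k
    startFall zero     = ∑-zero V (λ _ → ≈-refl)
    startFall (suc h′) = ≈-trans (∑-cong V (λ v → scaled (validFrom h′ k v)))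
      (≈-trans (∑-*ˡ (β (suc h′)) (weightIfValid h′ k) V) (*-congˡ (≈-sym (Jfrom≈∑ n h′ k))))

  δ : ℕ → ℕ → Carrier
  δ h k = if h ≡ᵇ k then 1# else 0#

  Jfrom-zero : ∀ h k → Jfrom 0 h k ≈ δ h k
  Jfrom-zero h k with h ≡ᵇ k
  ... | true  = +-identityʳ 1#
  ... | false = ≈-refl

  β-δ : ∀ h k → β (suc h) * δ h k ≈ β (suc k) * δ h k
  β-δ h k with h ≡ᵇ k in e
  ... | true  = reflexive (cong (λ x → β (suc x) * 1#) (≡ᵇ⇒≡ h k (subst T (sym e) _)))
  ... | false = ≈-trans (zeroʳ _) (≈-sym (zeroʳ _))

  -- The last-step decomposition is derived from the first-step one by induction on n.
  Jfrom-lastStep : ∀ n h k → Jfrom (suc n) h k ≈ lastRise n h k + β (suc k) * Jfrom n h (suc k)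
  Jfrom-lastStep zero h k = ≈-trans (Jfrom-firstStep zero h k) (+-cong (endRise h k) (startFall h k))
    where
    endRise : ∀ h k → Jfrom 0 (suc h) k ≈ lastRise 0 h k
    endRise h zero    = Jfrom-zero (suc h) zero
    endRise h (suc k) = ≈-trans (Jfrom-zero (suc h) (suc k)) (≈-sym (Jfrom-zero h k))
    startFall : ∀ h k → firstFall 0 h k ≈ β (suc k) * Jfrom 0 h (suc k)
    startFall zero    k = ≈-sym (≈-trans (*-congˡ (Jfrom-zero zero (suc k))) (zeroʳ _))
    startFall (suc h) k = ≈-trans (*-congˡ (Jfrom-zero h k)) (≈-trans (β-δ h k) (*-congˡ (≈-sym (Jfrom-zero (suc h) (suc k)))))
  Jfrom-lastStep (suc n) h k = begin
    Jfrom (suc (suc n)) h k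
      ≈⟨ Jfrom-firstStep (suc n) h k ⟩
    Jfrom (suc n) (suc h) k + firstFall (suc n) h k
      ≈⟨ +-cong (Jfrom-lastStep n (suc h) k) (fallThenLast h) ⟩
    (lastRise n (suc h) k + βk * Jfrom n (suc h) (suc k)) + (fallThenRise h k + βk * firstFall n h (suc k))
      ≈⟨ +-interchange _ _ _ _ ⟩
    (lastRise n (suc h) k + fallThenRise h k) + (βk * Jfrom n (suc h) (suc k) + βk * firstFall n h (suc k))
      ≈⟨ +-cong (lastRise-firstStep h k) (≈-sym (distribˡ βk _ _)) ⟩
    lastRise (suc n) h k + βk * (Jfrom n (suc h) (suc k) + firstFall n h (suc k))
      ≈⟨ +-congˡ (*-congˡ (≈-sym (Jfrom-firstStep n h (suc k)))) ⟩
    lastRise (suc n) h k + βk * Jfrom (suc n) h (suc k)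
      ∎
    where
    βk = β (suc k)
    fallThenRise : ℕ → ℕ → Carrier
    fallThenRise zero     k′ = 0#
    fallThenRise (suc h′) k′ = β (suc h′) * lastRise n h′ k′
    lastRise-firstStep : ∀ h k′ → lastRise n (suc h) k′ + fallThenRise h k′ ≈ lastRise (suc n) h k′
    lastRise-firstStep zero     zero     = +-identityˡ 0#
    lastRise-firstStep (suc h′) zero     = ≈-trans (+-identityˡ _) (zeroʳ _)
    lastRise-firstStep zero     (suc k′) = ≈-sym (Jfrom-firstStep n zero k′)
    lastRise-firstStep (suc h′) (suc k′) = ≈-sym (Jfrom-firstStep n (suc h′) k′)
    fallThenLast : ∀ h → firstFall (suc n) h k ≈ fallThenRise h k + βk * firstFall n h (suc k)
    fallThenLast zero     = ≈-sym (≈-trans (+-identityˡ _) (zeroʳ βk))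
    fallThenLast (suc h′) = begin
      β (suc h′) * Jfrom (suc n) h′ k                                        ≈⟨ *-congˡ (Jfrom-lastStep n h′ k) ⟩
      β (suc h′) * (lastRise n h′ k + βk * Jfrom n h′ (suc k))               ≈⟨ distribˡ _ _ _ ⟩
      β (suc h′) * lastRise n h′ k + β (suc h′) * (βk * Jfrom n h′ (suc k))  ≈⟨ +-congˡ (x∙yz≈y∙xz _ _ _) ⟩
      β (suc h′) * lastRise n h′ k + βk * (β (suc h′) * Jfrom n h′ (suc k))  ∎

targets : ∀ n → List (Maybe (Fin n))
targets n = nothing ∷ map just (allFin n)

module TailSums {c ℓ : Level} (R : CommutativeSemiring c ℓ) (n : ℕ) where
  open CommutativeSemiring R hiding (zero) renaming (refl to ≈-refl; sym to ≈-sym; trans to ≈-trans)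
  open Sums R
  open import Relation.Binary.Reasoning.Setoid setoid

  oldTargets : List (Maybe (Fin n))
  oldTargets = map just (allFin n)

  newTargets : List (Maybe (Fin (suc n)))
  newTargets = nothing ∷ just zero ∷ map (Maybe.map suc) oldTargets

  targets-suc : targets (suc n) ≡ newTargets
  targets-suc = cong (λ l → nothing ∷ just zero ∷ l)
    (trans (List.map-tabulate suc just)
           (sym (trans (cong (map (Maybe.map suc)) (List.map-tabulate id just)) (List.map-tabulate just (Maybe.map suc)))))

  Tails : ℕ → Set
  Tails m = Vec (Maybe (Fin (suc n))) m

  tails : ∀ m → List (Tails m)
  tails = allVecs newTargets

  ∑-tails-suc : ∀ m (g : Tails (suc m) → Carrier) →
    ∑ g (tails (suc m)) ≈ ∑ (λ t → g (nothing ∷ t)) (tails m) + (∑ (λ t → g (just zero ∷ t)) (tails m)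
                          + ∑ (λ a → ∑ (λ t → g (Maybe.map suc a ∷ t)) (tails m)) oldTargets)
  ∑-tails-suc m g = ≈-trans (∑-allVecs-suc newTargets m g) (+-congˡ (+-congˡ (reflexive (∑-map _ (Maybe.map suc) oldTargets))))

  ∑-targets-suc : ∀ m (g : Vec (Maybe (Fin n)) (suc m) → Carrier) →
    ∑ g (allVecs (targets n) (suc m)) ≈ ∑ (λ s → g (nothing ∷ s)) (allVecs (targets n) m)
                                        + ∑ (λ a → ∑ (λ s → g (a ∷ s)) (allVecs (targets n) m)) oldTargets
  ∑-targets-suc m g = ∑-allVecs-suc (targets n) m g

  ∑-oldTargets : ∀ {f g : Maybe (Fin n) → Carrier} → (∀ j → f (just j) ≈ g (just j)) → ∑ f oldTargets ≈ ∑ g oldTargets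
  ∑-oldTargets {f} {g} h = ≈-trans (reflexive (∑-map f just (allFin n)))
                             (≈-trans (∑-cong (allFin n) h) (reflexive (sym (∑-map g just (allFin n)))))

  ∑-tails-avoiding : ∀ m (h : Tails m → Carrier) → (∀ v i → lookup v i ≡ just zero → h v ≈ 0#) →
    ∑ h (tails m) ≈ ∑ (h ∘ shift) (allVecs (targets n) m)
  ∑-tails-avoiding zero    h vanish = ≈-refl
  ∑-tails-avoiding (suc m) h vanish = begin
    ∑ h (tails (suc m))
      ≈⟨ ∑-tails-suc m h ⟩
    rest nothing + (rest (just zero) + ∑ (rest ∘ Maybe.map suc) oldTargets)
      ≈⟨ +-cong (shifted nothing) (≈-trans (+-cong (∑-zero (tails m) (λ t → vanish (just zero ∷ t) zero refl))
                                                   (∑-cong oldTargets (shifted ∘ Maybe.map suc)))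
                                           (+-identityˡ _)) ⟩
    ∑ (λ s → h (nothing ∷ shift s)) V + ∑ (λ a → ∑ (λ s → h (Maybe.map suc a ∷ shift s)) V) oldTargets
      ≈⟨ ≈-sym (∑-targets-suc m (h ∘ shift)) ⟩
    ∑ (h ∘ shift) (allVecs (targets n) (suc m))
      ∎
    where
    V = allVecs (targets n) m
    rest : Maybe (Fin (suc n)) → Carrier
    rest x = ∑ (λ t → h (x ∷ t)) (tails m)
    shifted : ∀ x → rest x ≈ ∑ (λ s → h (x ∷ shift s)) V
    shifted x = ∑-tails-avoiding m (λ t → h (x ∷ t)) (λ v i e → vanish (x ∷ v) (suc i) e)

  -- the contributions of redirecting the end u of s to the new vertex
  redirection : ∀ {m} → (Tails m → Carrier) → Vec (Maybe (Fin n)) m → Fin m → Carrier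
  redirection g s u = if is-nothing (lookup s u) then g (shift s [ u ]≔ just zero) else 0#

  redirections : ∀ {m} → (Tails m → Carrier) → Vec (Maybe (Fin n)) m → Carrier
  redirections {m} g s = ∑ (redirection g s) (allFin m)

  ∑-tails : ∀ m (g : Tails m → Carrier) →
    (∀ v i j → i ≢ j → lookup v i ≡ just zero → lookup v j ≡ just zero → g v ≈ 0#) →
    ∑ g (tails m) ≈ ∑ (λ s → g (shift s) + redirections g s) (allVecs (targets n) m)
  ∑-tails zero    g vanish = ≈-sym (+-congʳ (+-identityʳ (g [])))
  ∑-tails (suc m) g vanish = begin
    ∑ g (tails (suc m))                                                      ≈⟨ ∑-tails-suc m g ⟩
    rest nothing + (rest (just zero) + ∑ (rest ∘ Maybe.map suc) oldTargets)  ≈⟨ +-cong (split nothing) (+-congʳ toZero) ⟩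
    X + (Z + ∑ (rest ∘ Maybe.map suc) oldTargets)                            ≈⟨ ≈-sym (+-assoc X Z _) ⟩
    (X + Z) + ∑ (rest ∘ Maybe.map suc) oldTargets
      ≈⟨ +-cong (≈-sym headNothing) (∑-oldTargets (λ j → ≈-trans (split (just (suc j))) (≈-sym (headJust j)))) ⟩
    ∑ (λ s → whole (nothing ∷ s)) V + ∑ (λ a → ∑ (λ s → whole (a ∷ s)) V) oldTargets
                                                                             ≈⟨ ≈-sym (∑-targets-suc m whole) ⟩
    ∑ whole (allVecs (targets n) (suc m))                                    ∎
    where
    V = allVecs (targets n) m
    whole : Vec (Maybe (Fin n)) (suc m) → Carrier
    whole s = g (shift s) + redirections g s
    rest : Maybe (Fin (suc n)) → Carrier
    rest x = ∑ (λ t → g (x ∷ t)) (tails m)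
    split : ∀ x → rest x ≈ ∑ (λ s → g (x ∷ shift s) + redirections (λ t → g (x ∷ t)) s) V
    split x = ∑-tails m (λ t → g (x ∷ t)) (λ v i j i≢j ei ej → vanish (x ∷ v) (suc i) (suc j) (i≢j ∘ suc-injective) ei ej)
    toZero : rest (just zero) ≈ ∑ (λ s → g (just zero ∷ shift s)) V
    toZero = ∑-tails-avoiding m (λ t → g (just zero ∷ t)) (λ v i e → vanish (just zero ∷ v) zero (suc i) 0≢1+n refl e)
    X = ∑ (λ s → g (nothing ∷ shift s) + redirections (λ t → g (nothing ∷ t)) s) V
    Z = ∑ (λ s → g (just zero ∷ shift s)) V
    headNothing : ∑ (λ s → whole (nothing ∷ s)) V ≈ X + Z
    headNothing = ≈-trans (∑-cong V (λ s → ≈-trans (+-congˡ (∑-allFin-suc (redirection g (nothing ∷ s))))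
                                               (≈-trans (+-congˡ (+-comm _ _)) (≈-sym (+-assoc _ _ _)))))
                          (∑-+ _ _ V)
    headJust : ∀ j → ∑ (λ s → whole (just j ∷ s)) V
                     ≈ ∑ (λ s → g (just (suc j) ∷ shift s) + redirections (λ t → g (just (suc j) ∷ t)) s) V
    headJust j = ∑-cong V (λ s → +-congˡ (≈-trans (∑-allFin-suc (redirection g (just j ∷ s))) (+-identityˡ _)))

module AlternatingDigraphs {c ℓ : Level} (R : CommutativeSemiring c ℓ) (α : CommutativeSemiring.Carrier R) where
  open CommutativeSemiring R hiding (zero) renaming (refl to ≈-refl; sym to ≈-sym; trans to ≈-trans)
  open Weights R
  open Sums R
  open import Relation.Binary.Reasoning.Setoid setoid
  open CommutativeSemigroupProperties +-commutativeSemigroup using () renaming (interchange to +-interchange)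

  β : ℕ → Carrier
  β i = ι i * (ι i + α)

  cycleWeight : ∀ {n} → SuccMap n → Carrier
  cycleWeight σ = pow (1# + α) (cyc σ)

  selectWeight : Bool → Bool → Bool → Carrier → Carrier
  selectWeight laguerre alternating paths x = if laguerre then (if alternating ∧ paths then x else 0#) else 0#

  selectWeight-cong : ∀ {a a′ b b′ p p′ x x′} → a ≡ a′ → b ≡ b′ → p ≡ p′ → x ≡ x′ →
    selectWeight a b p x ≡ selectWeight a′ b′ p′ x′
  selectWeight-cong refl refl refl refl = refl

  weight : ∀ {n} → ℕ → SuccMap n → Carrier
  weight k σ = selectWeight (isLaguerre σ) (isAlternating σ) (numPaths σ ≡ᵇ k) (cycleWeight σ)

  -- the right-hand side, summed over all successor maps instead of LD^alt_{n,k}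
  LD : ℕ → ℕ → Carrier
  LD n k = ∑ (weight k) (allVecs (targets n) n)

  LDalt≈LD : ∀ n k → sumR (map cycleWeight (LDalt n k)) ≈ LD n k
  LDalt≈LD n k = ≈-trans (∑-filterB cycleWeight _ (allLaguerre n)) (∑-filterB _ isLaguerre (allVecs (targets n) n))

  weight-¬alternating : ∀ {n} k (σ : SuccMap n) → isAlternating σ ≡ false → weight k σ ≈ 0#
  weight-¬alternating k σ e rewrite e with isLaguerre σ
  ... | true  = ≈-refl
  ... | false = ≈-refl

  weight-¬laguerre : ∀ {n} k (σ : SuccMap n) → isLaguerre σ ≡ false → weight k σ ≈ 0#
  weight-¬laguerre k σ e rewrite e = ≈-refl

  twoPredecessors⇒¬laguerre : ∀ {n} x (v : Vec (Maybe (Fin (suc n))) n) i j → i ≢ j →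
    lookup v i ≡ just zero → lookup v j ≡ just zero → isLaguerre (x ∷ v) ≡ false
  twoPredecessors⇒¬laguerre x v i j i≢j ei ej =
    ¬-not λ e → i≢j (suc-injective (isLaguerre⇒IsLaguerre (x ∷ v) e (suc i) (suc j) zero ei ej))

  lastRiseWeight : ∀ {n} → ℕ → SuccMap n → Carrier
  lastRiseWeight zero    s = 0#
  lastRiseWeight (suc k) s = weight k s

  weight-isolated : ∀ {n} k (s : SuccMap n) → weight k (insertMin nothing s nothing) ≈ lastRiseWeight k s
  weight-isolated k s with isLaguerre s in eL
  ... | false = ≈-trans (weight-¬laguerre k (insertMin nothing s nothing) (trans isLaguerre-isolated eL)) (vanishes k)
    where
    open InsertIsolated s
    vanishes : ∀ k → 0# ≈ lastRiseWeight k s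
    vanishes zero    = ≈-refl
    vanishes (suc k) = ≈-sym (weight-¬laguerre k s eL)
  ... | true rewrite InsertIsolated.isLaguerre-isolated s | eL
                   | InsertIsolated.isAlternating-isolated s | InsertIsolated.numPaths-isolated s
                   | InsertIsolated.cyc-isolated s (trans (InsertIsolated.isLaguerre-isolated s) eL) = shifted k
    where
    shifted : ∀ k → (if isAlternating s ∧ (suc (numPaths s) ≡ᵇ k) then cycleWeight s else 0#) ≈ lastRiseWeight k s
    shifted zero    with isAlternating s
    ... | true  = ≈-refl
    ... | false = ≈-refl
    shifted (suc k) rewrite eL = ≈-refl

  closingFactor : ∀ {n} → SuccMap n → Fin n → Fin n → Carrier
  closingFactor s w u = if reachable s w u then 1# + α else 1#

  valleyFactor : ∀ {n} → SuccMap n → Fin n → Fin n → Carrier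
  valleyFactor s w u = if not (hasPred s w) then closingFactor s w u else 0#

  weight-valley : ∀ {n} k (s : SuccMap n) w u (free : lookup s u ≡ nothing) →
    weight k (insertMin (just (suc w)) s (just u)) ≈ weight (suc k) s * valleyFactor s w u
  weight-valley k s w u free = byLaguerre (isLaguerre σ) refl
    where
    open InsertValley s w u free
    σ = insertMin (just (suc w)) s (just u)
    byLaguerre : ∀ b → isLaguerre σ ≡ b → weight k σ ≈ weight (suc k) s * valleyFactor s w u
    byLaguerre false e = ≈-trans (weight-¬laguerre k σ e) (≈-sym vanishes)
      where
      vanishes : weight (suc k) s * valleyFactor s w u ≈ 0#
      vanishes with isLaguerre s in eL
      ... | false = zeroˡ _
      ... | true rewrite not-injective (trans (sym (cong (_∧ not (hasPred s w)) eL)) (trans (sym isLaguerre-valley) e)) = zeroʳ _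
    byLaguerre true e = begin
      weight k σ
        ≡⟨ selectWeight-cong e (isAlternating-valley e) (cong (_≡ᵇ suc k) (numPaths-valley e)) refl ⟩
      selectWeight true (isAlternating s) (numPaths s ≡ᵇ suc k) (cycleWeight σ)
        ≈⟨ selectWeight-* (isAlternating s ∧ (numPaths s ≡ᵇ suc k)) closing ⟩
      selectWeight true (isAlternating s) (numPaths s ≡ᵇ suc k) (cycleWeight s) * closingFactor s w u
        ≡⟨ cong₂ _*_ (cong (λ b → selectWeight b (isAlternating s) (numPaths s ≡ᵇ suc k) (cycleWeight s))
                           (sym (∧-conicalˡ (isLaguerre s) _ (isLaguerre-s e))))
                     (cong (λ b → if not b then closingFactor s w u else 0#) (sym (noPred-w e))) ⟩
      weight (suc k) s * valleyFactor s w u ∎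
      where
      closing : cycleWeight σ ≈ cycleWeight s * closingFactor s w u
      closing rewrite cyc-valley e with reachable s w u
      ... | true  = *-comm _ _
      ... | false = ≈-sym (*-identityʳ _)
      selectWeight-* : ∀ b {x y z} → x ≈ y * z → (if b then x else 0#) ≈ (if b then y else 0#) * z
      selectWeight-* true  h = h
      selectWeight-* false h = ≈-sym (zeroˡ _)
  valleyChoices : ∀ {n} → SuccMap n → Fin n → Carrier
  valleyChoices {n} s w = ∑ (λ u → if is-nothing (lookup s u) then valleyFactor s w u else 0#) (allFin n)

  ∑-ends-closing : ∀ {A : Set} (p q : A → Bool) xs →
    ∑ (λ u → if p u then (if q u then 1# + α else 1#) else 0#) xs ≈ ι (countB p xs) + ι (countB (λ u → p u ∧ q u) xs) * α
  ∑-ends-closing p q []       = ≈-sym (≈-trans (+-identityˡ _) (zeroˡ α))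
  ∑-ends-closing p q (x ∷ xs) with p x | q x
  ... | false | _     = ≈-trans (+-identityˡ _) (∑-ends-closing p q xs)
  ... | true  | false = ≈-trans (+-congˡ (∑-ends-closing p q xs)) (≈-sym (+-assoc _ _ _))
  ... | true  | true  = ≈-trans (+-congˡ (∑-ends-closing p q xs)) (begin
    (1# + α) + (ι a + ι b * α)      ≈⟨ +-interchange _ _ _ _ ⟩
    (1# + ι a) + (α + ι b * α)      ≈⟨ +-congˡ (+-congʳ (≈-sym (*-identityˡ α))) ⟩
    (1# + ι a) + (1# * α + ι b * α) ≈⟨ +-congˡ (≈-sym (distribʳ α 1# (ι b))) ⟩
    (1# + ι a) + (1# + ι b) * α     ∎)
    where
    a = countB p xs
    b = countB (λ u → p u ∧ q u) xs

  -- For each of the k + 1 starts w: k + 1 ends u to join to, exactly one of which closes a cycle.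
  ∑-valleyChoices : ∀ {n} (s : SuccMap n) k → IsLaguerre s → numPaths s ≡ suc k → ∑ (valleyChoices s) (allFin n) ≈ β (suc k)
  ∑-valleyChoices {n} s k L paths = begin
    ∑ (valleyChoices s) (allFin n)                                        ≈⟨ ∑-cong (allFin n) perStart ⟩
    ∑ (λ w → if not (hasPred s w) then K else 0#) (allFin n)              ≈⟨ ∑-indicator _ K (allFin n) ⟩
    ι (numPaths s) * K                                                    ≡⟨ cong (λ t → ι t * K) paths ⟩
    ι (suc k) * (ι #ends + ι 1 * α)
      ≈⟨ *-congˡ (+-cong (reflexive (cong ι (trans (#ends≡#starts s L) paths)))
                         (≈-trans (*-congʳ (+-identityʳ 1#)) (*-identityˡ α))) ⟩
    β (suc k)                                                             ∎
    where
    #ends = countB (λ u → is-nothing (lookup s u)) (allFin n)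
    K = ι #ends + ι 1 * α
    perStart : ∀ w → valleyChoices s w ≈ (if not (hasPred s w) then K else 0#)
    perStart w with hasPred s w in e
    ... | true  = ∑-zero (allFin n) (λ u → noValley (is-nothing (lookup s u)))
      where
      noValley : ∀ b → (if b then 0# else 0#) ≈ 0#
      noValley true  = ≈-refl
      noValley false = ≈-refl
    ... | false = ≈-trans (∑-ends-closing _ _ (allFin n))
                          (+-congˡ (*-congʳ (reflexive (cong ι (pathStart-uniqueEnd s L w e)))))

  weight-∑-valleyChoices : ∀ {n} (s : SuccMap n) k → weight (suc k) s * ∑ (valleyChoices s) (allFin n) ≈ weight (suc k) s * β (suc k)
  weight-∑-valleyChoices {n} s k with isLaguerre s in eL | isAlternating s ∧ (numPaths s ≡ᵇ suc k) in eA
  ... | false | _     = ≈-trans (zeroˡ _) (≈-sym (zeroˡ _))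
  ... | true  | false = ≈-trans (zeroˡ _) (≈-sym (zeroˡ _))
  ... | true  | true  = *-congˡ (∑-valleyChoices s k (isLaguerre⇒IsLaguerre s eL)
                                   (≡ᵇ⇒≡ (numPaths s) (suc k) (subst T (sym (∧-conicalʳ _ _ eA)) tt)))

  lastRiseLD : ℕ → ℕ → Carrier
  lastRiseLD n zero    = 0#
  lastRiseLD n (suc k) = LD n k

  -- Classify the digraphs on [n + 1] by the neighbours of the new vertex 1: isolated, a loop,
  -- only a successor, only a predecessor, or a valley.
  LD-recurrence : ∀ n k → LD (suc n) k ≈ lastRiseLD n k + β (suc k) * LD n (suc k)
  LD-recurrence n k = begin
    LD (suc n) k                                                             ≡⟨ cong (λ l → ∑ (weight k) (allVecs l (suc n))) targets-suc ⟩
    ∑ (weight k) (tails (suc n))                                             ≈⟨ ∑-tails-suc n (weight k) ⟩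
    rest nothing + (rest (just zero) + ∑ (rest ∘ Maybe.map suc) oldTargets)  ≈⟨ +-cong isolated (+-cong loop valleys) ⟩
    lastRiseLD n k + (0# + β (suc k) * LD n (suc k))                         ≈⟨ +-congˡ (+-identityˡ _) ⟩
    lastRiseLD n k + β (suc k) * LD n (suc k)                                ∎
    where
    open TailSums R n
    V = allVecs (targets n) n
    rest : Maybe (Fin (suc n)) → Carrier
    rest x = ∑ (λ t → weight k (x ∷ t)) (tails n)
    split : ∀ x → rest x ≈ ∑ (λ s → weight k (x ∷ shift s) + redirections (λ t → weight k (x ∷ t)) s) V
    split x = ∑-tails n (λ t → weight k (x ∷ t))
                (λ v i j i≢j ei ej → weight-¬laguerre k (x ∷ v) (twoPredecessors⇒¬laguerre x v i j i≢j ei ej))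
    noRedirection : ∀ x s → (∀ u → lookup s u ≡ nothing → weight k (insertMin x s (just u)) ≈ 0#) →
      redirections (λ t → weight k (x ∷ t)) s ≈ 0#
    noRedirection x s h = ∑-zero (allFin n) (λ u → byEnd u (lookup s u) refl)
      where
      byEnd : ∀ u y → lookup s u ≡ y → redirection (λ t → weight k (x ∷ t)) s u ≈ 0#
      byEnd u nothing  e rewrite e = h u e
      byEnd u (just _) e rewrite e = ≈-refl
    isolated : rest nothing ≈ lastRiseLD n k
    isolated = ≈-trans (split nothing)
      (≈-trans (∑-cong V (λ s → ≈-trans (+-cong (weight-isolated k s)
                                  (noRedirection nothing s λ u free →
                                    weight-¬alternating k (insertMin nothing s (just u)) (¬alternating-predOnly s u free)))
                                  (+-identityʳ _)))
               (byHeight k))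
      where
      byHeight : ∀ k → ∑ (lastRiseWeight k) V ≈ lastRiseLD n k
      byHeight zero    = ∑-zero V (λ _ → ≈-refl)
      byHeight (suc k) = ≈-refl
    loop : rest (just zero) ≈ 0#
    loop = ≈-trans (split (just zero)) (∑-zero V (λ s → ≈-trans
      (+-cong (weight-¬alternating k (insertMin (just zero) s nothing) (¬alternating-loop s nothing tt))
              (noRedirection (just zero) s λ u free →
                weight-¬alternating k (insertMin (just zero) s (just u)) (¬alternating-loop s (just u) free)))
      (+-identityˡ 0#)))
    valleysAt : ∀ w → rest (just (suc w)) ≈ ∑ (λ s → weight (suc k) s * valleyChoices s w) V
    valleysAt w = ≈-trans (split (just (suc w))) (∑-cong V (λ s →
      ≈-trans (+-cong (weight-¬alternating k (insertMin (just (suc w)) s nothing) (¬alternating-succOnly s w))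
                      (≈-trans (∑-cong (allFin n) (valley s)) (∑-*ˡ _ _ (allFin n))))
              (+-identityˡ _)))
      where
      valley : ∀ s u → redirection (λ t → weight k (just (suc w) ∷ t)) s u
                       ≈ weight (suc k) s * (if is-nothing (lookup s u) then valleyFactor s w u else 0#)
      valley s u with lookup s u in e
      ... | nothing = weight-valley k s w u e
      ... | just _  = ≈-sym (zeroʳ _)
    valleys : ∑ (rest ∘ Maybe.map suc) oldTargets ≈ β (suc k) * LD n (suc k)
    valleys = begin
      ∑ (rest ∘ Maybe.map suc) oldTargets                 ≡⟨ ∑-map (rest ∘ Maybe.map suc) just (allFin n) ⟩
      ∑ (λ w → rest (just (suc w))) (allFin n)            ≈⟨ ∑-cong (allFin n) valleysAt ⟩
      ∑ (λ w → ∑ (λ s → valleyWeight s w) V) (allFin n)   ≈⟨ ∑-swap (λ w s → valleyWeight s w) (allFin n) V ⟩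
      ∑ (λ s → ∑ (valleyWeight s) (allFin n)) V
        ≈⟨ ∑-cong V (λ s → ≈-trans (∑-*ˡ _ _ (allFin n)) (weight-∑-valleyChoices s k)) ⟩
      ∑ (λ s → weight (suc k) s * β (suc k)) V            ≈⟨ ∑-*ʳ _ _ V ⟩
      LD n (suc k) * β (suc k)                            ≈⟨ *-comm _ _ ⟩
      β (suc k) * LD n (suc k)                            ∎
      where
      valleyWeight : SuccMap n → Fin n → Carrier
      valleyWeight s w = weight (suc k) s * valleyChoices s w

  open LatticePaths R β using (noLevel; Jfrom; Jfrom-lastStep)

  Jfrom≈LD : ∀ n k → Jfrom n 0 k ≈ LD n k
  Jfrom≈LD zero    zero    = ≈-refl
  Jfrom≈LD zero    (suc k) = ≈-sym (+-identityʳ 0#)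
  Jfrom≈LD (suc n) k = ≈-trans (Jfrom-lastStep n 0 k)
    (≈-trans (+-cong (lastRise k) (*-congˡ (Jfrom≈LD n (suc k)))) (≈-sym (LD-recurrence n k)))
    where
    lastRise : ∀ k → LatticePaths.lastRise R β n 0 k ≈ lastRiseLD n k
    lastRise zero    = ≈-refl
    lastRise (suc k) = Jfrom≈LD n k

  J≈∑LDalt : ∀ n k → J n k β noLevel ≈ sumR (map cycleWeight (LDalt n k))
  J≈∑LDalt n k = ≈-trans (Jfrom≈LD n k) (≈-sym (LDalt≈LD n k))

proposition6p3 : ∀ {c ℓ : Level} (R : CommutativeSemiring c ℓ) (α : CommutativeSemiring.Carrier R) (n k : ℕ) →
    let open CommutativeSemiring R
        open Weights R
    in J n k (λ i → ι i * (ι i + α)) (λ _ → 0#)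
         ≈ sumR (map (λ G → pow (1# + α) (cyc G)) (LDalt n k))
proposition6p3 R α = AlternatingDigraphs.J≈∑LDalt R α
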